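{- For $n\in\mathbb N$ and $m\ge1$, $$\sum_{k\ge0}(-q)^{n-k}\,S^o[m,n,k]=1.$$
   Context: $[j]=[j]_q=1+q+\dots+q^{j-1}$. For an integer $l$, $[l]!_m=\prod[j]$ over all positive integers $j\le l$ with $j\equiv l\pmod m$ (empty product $=1$ when $l\le0$). Let $\zeta_m=e^{2\pi i/m}$, $i^c=\zeta_m^c\mathbf e_i$ for $i\in[n]$ (colors mod $m$), $[n^m]=\{0\}\cup\{i^c:i\in[n],0\le c<m\}$, $zS=\{zs:s\in S\}$. A colored set partition of type $(m,n)$ is a set partition of $[n^m]$ into blocks $S_0,\dots,S_{km}$ with (i) $0\in S_0$ and if some $i^c\in S_0$ then all $i^d\in S_0$; (ii) for each $0\le l<k$, $S_{lm+1},\dots,S_{(l+1)m}$ are distinct and of the form $S,\zeta_mS,\dots,\zeta_m^{m-1}S$. With $\operatorname{minb}S=0$ if $0\in S$ and otherwise the least base occurring in $S$, the standard form labels the blocks so that (ii) holds, $s_i=\operatorname{minb}S_i$ satisfy $0=s_0<s_m<\dots<s_{km}$, and $s_j^{\,r}\in S_j$ for $j\in[km]$ where $r=j\bmod m$. An inversion is a pair $(i^0,S_l)$ with $i^0\in S_j$, $j<l$, $i\ge s_l$ (in standard form). $S[m,n,k]=\sum q^{\operatorname{inv}\sigma}$ over type $(m,n)$ colored set partitions with $km+1$ blocks, and $S^o[m,n,k]=[(k-1)m+2]!_m\,S[m,n,k]$. -}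

module Defs where

open import Data.Nat as ℕ using (ℕ; zero; suc; _+_; _*_; _∸_; _<ᵇ_; _≡ᵇ_; _≤ᵇ_; NonZero)
open import Data.Nat.DivMod using (_%_; m%n<n)
open import Data.Nat.Divisibility using (_∣?_)
open import Data.Fin using (Fin; toℕ; fromℕ<)
open import Data.Vec as Vec using (Vec; []; _∷_; lookup)
open import Data.List as List using (List; []; _∷_; [_]; map; concatMap; filterᵇ; upTo; allFin; foldr; length)
open import Data.Bool.ListAction using (all; any)
open import Data.Product using (proj₁; proj₂)
open import Data.Bool using (Bool; true; false; if_then_else_; _∧_; _∨_; not)
open import Data.Integer as ℤ using (ℤ; +_; -[1+_])
open import Relation.Nullary.Decidable using (⌊_⌋)

qint : ℕ → ℤ → ℤ
qint j q = foldr ℤ._+_ (+ 0) (map (q ℤ.^_) (upTo j))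

-- [l]!_m = product of [j]_q over 1 ≤ j ≤ l with j ≡ l (mod m); 1 if l ≤ 0.
-- (For 1 ≤ j ≤ l, j ≡ l mod m iff m ∣ l ∸ j.)
mfact : ℕ → ℤ → ℤ → ℤ
mfact m (+ L) q =
  foldr ℤ._*_ (+ 1)
    (map (λ t → if ⌊ m ∣? (L ∸ suc t) ⌋ then qint (suc t) q else + 1) (upTo L))
mfact m -[1+ _ ] q = + 1

-- The element i^c of [n^m] (i ∈ [n], 0 ≤ c < m) is represented by
-- (i , c) : Fin n × Fin m, with base (toℕ i + 1) and colour (toℕ c).
-- The element 0 always lies in S_0.  A colored set partition in standard
-- form is encoded by its labelling: f i c = j  iff  i^c ∈ S_j.

Labelling : ℕ → ℕ → ℕ → Set
Labelling n m k = Vec (Vec (Fin (suc (k * m))) m) n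

vecs : {A : Set} → List A → (n : ℕ) → List (Vec A n)
vecs xs zero = [ [] ]
vecs xs (suc n) = concatMap (λ x → map (x ∷_) (vecs xs n)) xs

allLabellings : (n m k : ℕ) → List (Labelling n m k)
allLabellings n m k = vecs (vecs (allFin (suc (k * m))) m) n

module _ {n m k : ℕ} .{{_ : NonZero m}} (v : Labelling n m k) where

  f : Fin n → Fin m → ℕ
  f i c = toℕ (lookup (lookup v i) c)

  col : ℕ → Fin m
  col c = fromℕ< (m%n<n c m)

  ζ : Fin m → Fin m
  ζ c = col (suc (toℕ c))

  -- the block index of ζ S_j, for j ∈ [km]: within the group
  -- S_{lm+1},...,S_{lm+m}, cyclically shift by one.
  rot : ℕ → ℕ
  rot j = if j % m ≡ᵇ 0 then (j ∸ m) + 1 else j + 1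

  labels : List ℕ
  labels = map suc (upTo (k * m))

  -- minb S_j for j ≥ 1 (least base in S_j; 0 if S_j is empty)
  minb : ℕ → ℕ
  minb j = go (allFin n)
    where
    go : List (Fin n) → ℕ
    go [] = 0
    go (i ∷ is) = if any (λ c → f i c ≡ᵇ j) (allFin m) then suc (toℕ i) else go is

  -- s_j = minb S_j  (s_0 = 0 since 0 ∈ S_0)
  s : ℕ → ℕ
  s zero = 0
  s (suc j) = minb (suc j)

  -- every block S_j, j ∈ [km], is nonempty (S_0 ∋ 0 always)
  nonemptyB : Bool
  nonemptyB = all (λ j → any (λ i → any (λ c → f i c ≡ᵇ j) (allFin m)) (allFin n)) labels

  condI : Bool
  condI = all (λ i → all (λ c → not (f i c ≡ᵇ 0) ∨ all (λ d → f i d ≡ᵇ 0) (allFin m))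
                         (allFin m)) (allFin n)

  -- condition (ii): ζ S_{lm+t} ⊆ S_{rot (lm+t)}, i.e. the group
  -- S_{lm+1},...,S_{(l+1)m} is S, ζS, ..., ζ^{m-1}S
  condII : Bool
  condII = all (λ i → all (λ c → (f i c ≡ᵇ 0) ∨ (f i (ζ c) ≡ᵇ rot (f i c)))
                          (allFin m)) (allFin n)

  stdOrder : Bool
  stdOrder = all (λ l → s (l * m) <ᵇ s (suc l * m)) (upTo k)

  stdColour : Bool
  stdColour = all (λ j → any (λ i → (suc (toℕ i) ≡ᵇ s j) ∧ (f i (col j) ≡ᵇ j)) (allFin n)) labels

  isColoredSetPartition : Bool
  isColoredSetPartition = nonemptyB ∧ condI ∧ condII ∧ stdOrder ∧ stdColour

  inv : ℕ
  inv = length (filterᵇ (λ p → (f (proj₁ p) (col 0) <ᵇ proj₂ p)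
                              ∧ (s (proj₂ p) ≤ᵇ suc (toℕ (proj₁ p))))
                        (List.cartesianProduct (allFin n) labels))

Sq : (m n k : ℕ) .{{_ : NonZero m}} → ℤ → ℤ
Sq m n k q = foldr ℤ._+_ (+ 0)
  (map (λ v → q ℤ.^ inv {n} {m} {k} v) (filterᵇ (isColoredSetPartition {n} {m} {k}) (allLabellings n m k)))

Soq : (m n k : ℕ) .{{_ : NonZero m}} → ℤ → ℤ
Soq m n k q = mfact m (((+ k ℤ.- + 1) ℤ.* + m) ℤ.+ + 2) q ℤ.* Sq m n k q

lhs : (m n : ℕ) .{{_ : NonZero m}} → ℤ → ℤ
lhs m n q = foldr ℤ._+_ (+ 0) (map (λ k → (ℤ.- q) ℤ.^ (n ∸ k) ℤ.* Soq m n k q) (upTo (suc n)))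

-- Write S_k(n) = S[m,n,k] and P_k = [(k-1)m+2]!_m, so that P_{k+1} = [km+2] P_k.
-- Deleting the element of largest base n+1 from a partition with km+1 blocks gives
-- S_k(n+1) = [km+1] S_k(n) + S_{k-1}(n).  Indeed the row of n+1 is fixed by the block S_j
-- of its colour-0 element, the other colours lying in the rotations of S_j within its
-- group.  If j = 0 or S_j already meets the first n rows, the rest is a partition with
-- km+1 blocks and n+1 adds km-j inversions; these choices contribute
-- q^{km} + q^{km-1} + ... + 1 = [km+1].  Otherwise the row opens the last group on its
-- own, which forces j = km and adds no inversion.  As [km+2] - q[km+1] = 1, the sum
-- Σ_k (-q)^{n-k} P_k S_k(n) does not depend on n, and it is 1 for n = 0.
module Submission where

open import Data.Bool using (Bool; true; false; if_then_else_; T; _∧_; _∨_; not)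
open import Data.Bool.Properties using (T?; T-∧; T-∨; T-≡; T-not-≡; ∧-identityʳ; ∨-identityʳ; ∨-assoc)
open import Data.Bool.ListAction using (all; any; and; or)
open import Data.Empty using (⊥-elim)
open import Data.Fin as Fin using (Fin; toℕ)
open import Data.Integer as ℤ using (ℤ; +_)
import Data.Integer.Properties as ℤP
open import Data.List as List using (List; []; _∷_; map; foldr; upTo; _++_; filterᵇ; concatMap; allFin; cartesianProduct; length)
import Data.List.Properties as LP
open import Data.List.Membership.Propositional using (_∈_; find; lose)
open import Data.List.Membership.Propositional.Properties using (∈-upTo⁺; ∈-upTo⁻; ∈-map⁺; ∈-map⁻; ∈-concatMap⁻)
import Data.List.Relation.Unary.All as All
import Data.List.Relation.Unary.All.Properties as AllP
open import Data.List.Relation.Unary.Any using (here; there)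
import Data.List.Relation.Unary.Any.Properties as AnyP
open import Data.Nat as ℕ using (ℕ; zero; suc; NonZero; _≤_; _<_; s≤s; z≤n; _∸_; _≡ᵇ_; _<ᵇ_; _≤ᵇ_)
open import Data.Nat.DivMod using (_%_; _/_; %-distribˡ-+; m%n%n≡m%n; [m+kn]%n≡m%n; [m+n]%n≡m%n; n%n≡0; m%n<n)
open import Data.Nat.DivMod using (+-distrib-/; m*n%n≡0; m*n/n≡m; m<n⇒m%n≡m; m<n⇒m/n≡0; m<n*o⇒m/o<n; m≡m%n+[m/n]*n)
open import Data.Nat.ListAction using (sum)
open import Data.Nat.ListAction.Properties using (sum-++)
import Data.Nat.Properties as ℕP
open import Data.Product using (Σ; _×_; _,_; proj₁; proj₂)
open import Data.Sum using (_⊎_; inj₁; inj₂)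
open import Data.Vec as Vec using (Vec; []; _∷_)
import Data.Vec.Properties as VecP
open import Data.Vec.Relation.Unary.All as VAll using ([]; _∷_)
import Data.Vec.Relation.Unary.All.Properties as VAllP
open import Function using (_∘_; id; Equivalence)
open import Relation.Binary.PropositionalEquality
open import Relation.Nullary using (¬_; Dec; yes; no)

open import Defs using (Labelling; vecs; qint; mfact; Sq; lhs)
import Defs as D

open Equivalence using (to; from)

module IntegerSums where

  open import Data.Integer using (_+_; _*_)
  open import Algebra.Properties.CommutativeSemigroup ℤP.+-commutativeSemigroup using (interchange)

  private variable A B : Set

  Σ< : ℕ → (ℕ → ℤ) → ℤ
  Σ< zero    g = + 0
  Σ< (suc N) g = Σ< N g + g N

  Π< : ℕ → (ℕ → ℤ) → ℤ
  Π< zero    g = + 1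
  Π< (suc N) g = Π< N g * g N

  ΣL : List A → (A → ℤ) → ℤ
  ΣL xs g = foldr _+_ (+ 0) (map g xs)

  ΠL : List A → (A → ℤ) → ℤ
  ΠL xs g = foldr _*_ (+ 1) (map g xs)

  ΣL-++ : ∀ (xs ys : List A) g → ΣL (xs ++ ys) g ≡ ΣL xs g + ΣL ys g
  ΣL-++ []       ys g = sym (ℤP.+-identityˡ _)
  ΣL-++ (x ∷ xs) ys g = trans (cong (_+_ (g x)) (ΣL-++ xs ys g)) (sym (ℤP.+-assoc (g x) _ _))

  ΠL-++ : ∀ (xs ys : List A) g → ΠL (xs ++ ys) g ≡ ΠL xs g * ΠL ys g
  ΠL-++ []       ys g = sym (ℤP.*-identityˡ _)
  ΠL-++ (x ∷ xs) ys g = trans (cong (g x *_) (ΠL-++ xs ys g)) (sym (ℤP.*-assoc (g x) _ _))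

  ΣL-upTo : ∀ N g → ΣL (upTo N) g ≡ Σ< N g
  ΣL-upTo zero    g = refl
  ΣL-upTo (suc N) g = begin
    ΣL (upTo (suc N)) g        ≡⟨ cong (λ xs → ΣL xs g) (LP.upTo-∷ʳ N) ⟨
    ΣL (upTo N List.∷ʳ N) g    ≡⟨ ΣL-++ (upTo N) (N ∷ []) g ⟩
    ΣL (upTo N) g + (g N + + 0) ≡⟨ cong₂ _+_ (ΣL-upTo N g) (ℤP.+-identityʳ (g N)) ⟩
    Σ< N g + g N               ∎
    where open ≡-Reasoning

  ΠL-upTo : ∀ N g → ΠL (upTo N) g ≡ Π< N g
  ΠL-upTo zero    g = refl
  ΠL-upTo (suc N) g = begin
    ΠL (upTo (suc N)) g        ≡⟨ cong (λ xs → ΠL xs g) (LP.upTo-∷ʳ N) ⟨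
    ΠL (upTo N List.∷ʳ N) g    ≡⟨ ΠL-++ (upTo N) (N ∷ []) g ⟩
    ΠL (upTo N) g * (g N * + 1) ≡⟨ cong₂ _*_ (ΠL-upTo N g) (ℤP.*-identityʳ (g N)) ⟩
    Π< N g * g N               ∎
    where open ≡-Reasoning

  Σ<-cong : ∀ N {g h} → (∀ k → k < N → g k ≡ h k) → Σ< N g ≡ Σ< N h
  Σ<-cong zero    e = refl
  Σ<-cong (suc N) e = cong₂ _+_ (Σ<-cong N (λ k k<N → e k (ℕP.m<n⇒m<1+n k<N))) (e N ℕP.≤-refl)

  Π<-cong : ∀ N {g h} → (∀ k → k < N → g k ≡ h k) → Π< N g ≡ Π< N h
  Π<-cong zero    e = refl
  Π<-cong (suc N) e = cong₂ _*_ (Π<-cong N (λ k k<N → e k (ℕP.m<n⇒m<1+n k<N))) (e N ℕP.≤-refl)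

  Σ<-zero : ∀ N {g} → (∀ k → k < N → g k ≡ + 0) → Σ< N g ≡ + 0
  Σ<-zero N e = trans (Σ<-cong N e) (zeros N)
    where
    zeros : ∀ N → Σ< N (λ _ → + 0) ≡ + 0
    zeros zero    = refl
    zeros (suc N) = cong (_+ + 0) (zeros N)

  Π<-one : ∀ N {g} → (∀ k → k < N → g k ≡ + 1) → Π< N g ≡ + 1
  Π<-one N e = trans (Π<-cong N e) (ones N)
    where
    ones : ∀ N → Π< N (λ _ → + 1) ≡ + 1
    ones zero    = refl
    ones (suc N) = cong (_* + 1) (ones N)

  Σ<-suc : ∀ N g → Σ< (suc N) g ≡ g 0 + Σ< N (g ∘ suc)
  Σ<-suc zero    g = trans (ℤP.+-identityˡ (g 0)) (sym (ℤP.+-identityʳ (g 0)))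
  Σ<-suc (suc N) g = trans (cong (_+ g (suc N)) (Σ<-suc N g)) (ℤP.+-assoc (g 0) _ _)

  Σ<-+ : ∀ N g h → Σ< N (λ k → g k + h k) ≡ Σ< N g + Σ< N h
  Σ<-+ zero    g h = refl
  Σ<-+ (suc N) g h = trans (cong (_+ (g N + h N)) (Σ<-+ N g h)) (interchange (Σ< N g) (Σ< N h) (g N) (h N))

  Σ<-*ˡ : ∀ N a g → Σ< N (λ k → a * g k) ≡ a * Σ< N g
  Σ<-*ˡ zero    a g = sym (ℤP.*-zeroʳ a)
  Σ<-*ˡ (suc N) a g = trans (cong (_+ a * g N) (Σ<-*ˡ N a g)) (sym (ℤP.*-distribˡ-+ a (Σ< N g) (g N)))

  Π<-+ : ∀ a b g → Π< (a ℕ.+ b) g ≡ Π< a g * Π< b (λ u → g (a ℕ.+ u))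
  Π<-+ a zero    g = trans (cong (λ N → Π< N g) (ℕP.+-identityʳ a)) (sym (ℤP.*-identityʳ _))
  Π<-+ a (suc b) g = begin
    Π< (a ℕ.+ suc b) g                                 ≡⟨ cong (λ N → Π< N g) (ℕP.+-suc a b) ⟩
    Π< (a ℕ.+ b) g * g (a ℕ.+ b)                       ≡⟨ cong (_* g (a ℕ.+ b)) (Π<-+ a b g) ⟩
    (Π< a g * Π< b (λ u → g (a ℕ.+ u))) * g (a ℕ.+ b)  ≡⟨ ℤP.*-assoc (Π< a g) _ _ ⟩
    Π< a g * (Π< b (λ u → g (a ℕ.+ u)) * g (a ℕ.+ b))  ∎
    where open ≡-Reasoning

  Σ<-single : ∀ N {g} y → y < N → (∀ x → x < N → x ≢ y → g x ≡ + 0) → Σ< N g ≡ g y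
  Σ<-single (suc N) {g} y y<1+N h with ℕP.m≤n⇒m<n∨m≡n (ℕP.≤-pred y<1+N)
  ... | inj₁ y<N = begin
    Σ< N g + g N ≡⟨ cong₂ _+_ (Σ<-single N y y<N (λ x x<N → h x (ℕP.m<n⇒m<1+n x<N)))
                               (h N ℕP.≤-refl (λ N≡y → ℕP.<⇒≢ y<N (sym N≡y))) ⟩
    g y + + 0    ≡⟨ ℤP.+-identityʳ (g y) ⟩
    g y          ∎
    where open ≡-Reasoning
  ... | inj₂ refl = begin
    Σ< N g + g N ≡⟨ cong (_+ g N) (Σ<-zero N (λ x x<N → h x (ℕP.m<n⇒m<1+n x<N) (ℕP.<⇒≢ x<N))) ⟩
    + 0 + g N    ≡⟨ ℤP.+-identityˡ (g N) ⟩
    g N          ∎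
    where open ≡-Reasoning

  ΣL-cong : ∀ (xs : List A) {g h : A → ℤ} → (∀ x → x ∈ xs → g x ≡ h x) → ΣL xs g ≡ ΣL xs h
  ΣL-cong []       e = refl
  ΣL-cong (x ∷ xs) e = cong₂ _+_ (e x (here refl)) (ΣL-cong xs (λ y y∈ → e y (there y∈)))

  ΣL-map : ∀ (xs : List A) (f : A → B) g → ΣL (map f xs) g ≡ ΣL xs (g ∘ f)
  ΣL-map xs f g = cong (foldr _+_ (+ 0)) (sym (LP.map-∘ xs))

  ΣL-concatMap : ∀ (xs : List A) (f : A → List B) g → ΣL (concatMap f xs) g ≡ ΣL xs (λ x → ΣL (f x) g)
  ΣL-concatMap []       f g = refl
  ΣL-concatMap (x ∷ xs) f g = trans (ΣL-++ (f x) (concatMap f xs) g) (cong (_+_ (ΣL (f x) g)) (ΣL-concatMap xs f g))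

  ΣL-+ : ∀ (xs : List A) g h → ΣL xs (λ x → g x + h x) ≡ ΣL xs g + ΣL xs h
  ΣL-+ []       g h = refl
  ΣL-+ (x ∷ xs) g h = trans (cong (_+_ (g x + h x)) (ΣL-+ xs g h)) (interchange (g x) (h x) (ΣL xs g) (ΣL xs h))

  ΣL-*ˡ : ∀ (xs : List A) a g → ΣL xs (λ x → a * g x) ≡ a * ΣL xs g
  ΣL-*ˡ []       a g = sym (ℤP.*-zeroʳ a)
  ΣL-*ˡ (x ∷ xs) a g = trans (cong (_+_ (a * g x)) (ΣL-*ˡ xs a g)) (sym (ℤP.*-distribˡ-+ a (g x) (ΣL xs g)))

  ΣL-zero : ∀ (xs : List A) {g} → (∀ x → x ∈ xs → g x ≡ + 0) → ΣL xs g ≡ + 0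
  ΣL-zero xs e = trans (ΣL-cong xs e) (zeros xs)
    where
    zeros : ∀ (xs : List A) → ΣL xs (λ _ → + 0) ≡ + 0
    zeros []       = refl
    zeros (x ∷ xs) = cong (_+_ (+ 0)) (zeros xs)

  ΣL-filter : ∀ (xs : List A) p g → ΣL (filterᵇ p xs) g ≡ ΣL xs (λ x → if p x then g x else + 0)
  ΣL-filter []       p g = refl
  ΣL-filter (x ∷ xs) p g with p x
  ... | true  = cong (_+_ (g x)) (ΣL-filter xs p g)
  ... | false = trans (ΣL-filter xs p g) (sym (ℤP.+-identityˡ _))

module QFactorials where

  open IntegerSums
  open import Data.Integer using (_+_; _*_; _-_; _^_)
  open import Data.Nat.Divisibility using (_∣_; _∣?_; ∣m+n∣m⇒∣n; ∣m∣n⇒∣m+n; ∣-refl; _∣0; ∣⇒≤)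
  open import Relation.Nullary.Decidable using (⌊_⌋; isYes≗does; dec-true; dec-false)

  qint-suc : ∀ N q → qint (suc N) q ≡ + 1 + q * qint N q
  qint-suc N q = begin
    qint (suc N) q                    ≡⟨ ΣL-upTo (suc N) (q ^_) ⟩
    Σ< (suc N) (q ^_)                 ≡⟨ Σ<-suc N (q ^_) ⟩
    + 1 + Σ< N (λ k → q * q ^ k)      ≡⟨ cong (_+_ (+ 1)) (Σ<-*ˡ N q (q ^_)) ⟩
    + 1 + q * Σ< N (q ^_)             ≡⟨ cong (λ s → + 1 + q * s) (ΣL-upTo N (q ^_)) ⟨
    + 1 + q * qint N q                ∎
    where open ≡-Reasoning

  qint-sucʳ : ∀ N q → qint (suc N) q ≡ qint N q + q ^ N
  qint-sucʳ N q = trans (ΣL-upTo (suc N) (q ^_)) (cong (_+ q ^ N) (sym (ΣL-upTo N (q ^_))))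

  qint-reversed : ∀ K q → Σ< K (λ j → q ^ (K ∸ suc j)) ≡ qint K q
  qint-reversed zero    q = refl
  qint-reversed (suc K) q = begin
    Σ< K (λ j → q ^ (K ∸ j)) + q ^ (K ∸ K)
      ≡⟨ cong₂ _+_ (Σ<-cong K (λ j j<K → cong (q ^_) (ℕP.+-∸-assoc 1 j<K))) (cong (q ^_) (ℕP.n∸n≡0 K)) ⟩
    Σ< K (λ j → q * q ^ (K ∸ suc j)) + + 1
      ≡⟨ cong (_+ + 1) (trans (Σ<-*ˡ K q _) (cong (q *_) (qint-reversed K q))) ⟩
    q * qint K q + + 1  ≡⟨ ℤP.+-comm (q * qint K q) (+ 1) ⟩
    + 1 + q * qint K q  ≡⟨ qint-suc K q ⟨
    qint (suc K) q      ∎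
    where open ≡-Reasoning

  mfactor : ℕ → ℕ → ℤ → ℕ → ℤ
  mfactor m L q t = if ⌊ m ∣? (L ∸ suc t) ⌋ then qint (suc t) q else + 1

  mfact-Π< : ∀ m L q → mfact m (+ L) q ≡ Π< L (mfactor m L q)
  mfact-Π< m L q = ΠL-upTo L (mfactor m L q)

  ∣?-+m : ∀ m x → ⌊ m ∣? (x ℕ.+ m) ⌋ ≡ ⌊ m ∣? x ⌋
  ∣?-+m m x with m ∣? (x ℕ.+ m) | m ∣? x
  ... | yes _   | yes _   = refl
  ... | no  _   | no  _   = refl
  ... | yes m∣x+m | no m∤x = ⊥-elim (m∤x (∣m+n∣m⇒∣n (subst (m ∣_) (ℕP.+-comm x m) m∣x+m) ∣-refl))
  ... | no m∤x+m | yes m∣x = ⊥-elim (m∤x+m (∣m∣n⇒∣m+n m∣x ∣-refl))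

  ∣?-0 : ∀ m → ⌊ m ∣? 0 ⌋ ≡ true
  ∣?-0 m = trans (isYes≗does (m ∣? 0)) (dec-true (m ∣? 0) (m ∣0))

  ∣?-below : ∀ m x → 0 < x → x < m → ⌊ m ∣? x ⌋ ≡ false
  ∣?-below m x 0<x x<m = trans (isYes≗does (m ∣? x)) (dec-false (m ∣? x) (λ m∣x → ℕP.<⇒≱ x<m (∣⇒≤ {{ℕ.>-nonZero 0<x}} m∣x)))

  mfactor-window : ∀ m A m' q → 0 < m' → m' ≤ m → Π< m' (λ u → mfactor m (A ℕ.+ m') q (A ℕ.+ u)) ≡ qint (A ℕ.+ m') q
  mfactor-window m A (suc m'') q _ m'≤m = begin
    Π< m'' G * G m''          ≡⟨ cong₂ _*_ (Π<-one m'' trivial) lastFactor ⟩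
    + 1 * qint (suc (A ℕ.+ m'')) q ≡⟨ ℤP.*-identityˡ _ ⟩
    qint (suc (A ℕ.+ m'')) q  ≡⟨ cong (λ x → qint x q) (ℕP.+-suc A m'') ⟨
    qint (A ℕ.+ suc m'') q    ∎
    where
    open ≡-Reasoning
    G = λ u → mfactor m (A ℕ.+ suc m'') q (A ℕ.+ u)
    gap : ∀ u → A ℕ.+ suc m'' ∸ suc (A ℕ.+ u) ≡ m'' ∸ u
    gap u = trans (cong (A ℕ.+ suc m'' ∸_) (sym (ℕP.+-suc A u))) (ℕP.[m+n]∸[m+o]≡n∸o A (suc m'') (suc u))
    lastFactor : G m'' ≡ qint (suc (A ℕ.+ m'')) q
    lastFactor = cong (λ b → if b then _ else + 1)
      (trans (cong (λ x → ⌊ m ∣? x ⌋) (trans (gap m'') (ℕP.n∸n≡0 m''))) (∣?-0 m))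
    trivial : ∀ u → u < m'' → G u ≡ + 1
    trivial u u<m'' = cong (λ b → if b then _ else + 1)
      (trans (cong (λ x → ⌊ m ∣? x ⌋) (gap u))
             (∣?-below m (m'' ∸ u) (ℕP.m<n⇒0<n∸m u<m'') (ℕP.<-≤-trans (s≤s (ℕP.m∸n≤m m'' u)) m'≤m)))

  mfact-+m : ∀ m .{{_ : NonZero m}} L q → mfact m (+ (L ℕ.+ m)) q ≡ qint (L ℕ.+ m) q * mfact m (+ L) q
  mfact-+m m L q = begin
    mfact m (+ (L ℕ.+ m)) q                         ≡⟨ mfact-Π< m (L ℕ.+ m) q ⟩
    Π< (L ℕ.+ m) (mfactor m (L ℕ.+ m) q)            ≡⟨ Π<-+ L m (mfactor m (L ℕ.+ m) q) ⟩
    Π< L (mfactor m (L ℕ.+ m) q) * Π< m (λ u → mfactor m (L ℕ.+ m) q (L ℕ.+ u))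
      ≡⟨ cong₂ _*_ (Π<-cong L shifted) (mfactor-window m L m q (ℕ.>-nonZero⁻¹ m) ℕP.≤-refl) ⟩
    Π< L (mfactor m L q) * qint (L ℕ.+ m) q         ≡⟨ ℤP.*-comm (Π< L (mfactor m L q)) (qint (L ℕ.+ m) q) ⟩
    qint (L ℕ.+ m) q * Π< L (mfactor m L q)         ≡⟨ cong (qint (L ℕ.+ m) q *_) (mfact-Π< m L q) ⟨
    qint (L ℕ.+ m) q * mfact m (+ L) q              ∎
    where
    open ≡-Reasoning
    shifted : ∀ t → t < L → mfactor m (L ℕ.+ m) q t ≡ mfactor m L q t
    shifted t t<L = cong (λ b → if b then qint (suc t) q else + 1)
      (trans (cong (λ x → ⌊ m ∣? x ⌋) (ℕP.+-∸-comm m t<L)) (∣?-+m m (L ∸ suc t)))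

  prefactor : (m : ℕ) .{{_ : NonZero m}} → ℕ → ℤ → ℤ
  prefactor m k q = mfact m (((+ k - + 1) * + m) + + 2) q

  prefactor-zero : ∀ m .{{_ : NonZero m}} q → prefactor m 0 q ≡ + 1
  prefactor-zero (suc zero)             q = refl
  prefactor-zero (suc (suc zero))       q = refl
  prefactor-zero (suc (suc (suc m)))    q = refl

  prefactor-suc : ∀ m .{{_ : NonZero m}} k q → prefactor m (suc k) q ≡ qint (k ℕ.* m ℕ.+ 2) q * prefactor m k q
  prefactor-suc m zero q = begin
    mfact m (+ 2) q          ≡⟨ mfact-2 m ⟩
    qint 2 q                 ≡⟨ ℤP.*-identityʳ (qint 2 q) ⟨
    qint 2 q * + 1           ≡⟨ cong (qint 2 q *_) (prefactor-zero m q) ⟨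
    qint 2 q * prefactor m 0 q ∎
    where
    open ≡-Reasoning
    mfact-2 : ∀ m .{{_ : NonZero m}} → mfact m (+ 2) q ≡ qint 2 q
    mfact-2 (suc zero)    = trans (mfact-+m 1 1 q) (ℤP.*-identityʳ (qint 2 q))
    mfact-2 m@(suc (suc _)) = trans (mfact-Π< m 2 q) (mfactor-window m 0 2 q (s≤s z≤n) (s≤s (s≤s z≤n)))
  prefactor-suc m (suc k) q = begin
    prefactor m (2 ℕ.+ k) q                         ≡⟨ prefactor-pos (suc k) ⟩
    mfact m (+ (suc k ℕ.* m ℕ.+ 2)) q               ≡⟨ cong (λ x → mfact m (+ x) q) reorder ⟩
    mfact m (+ (k ℕ.* m ℕ.+ 2 ℕ.+ m)) q             ≡⟨ mfact-+m m (k ℕ.* m ℕ.+ 2) q ⟩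
    qint (k ℕ.* m ℕ.+ 2 ℕ.+ m) q * mfact m (+ (k ℕ.* m ℕ.+ 2)) q
      ≡⟨ cong₂ (λ x y → qint x q * y) (sym reorder) (sym (prefactor-pos k)) ⟩
    qint (suc k ℕ.* m ℕ.+ 2) q * prefactor m (suc k) q ∎
    where
    open ≡-Reasoning
    reorder : suc k ℕ.* m ℕ.+ 2 ≡ k ℕ.* m ℕ.+ 2 ℕ.+ m
    reorder = trans (ℕP.+-assoc m (k ℕ.* m) 2) (ℕP.+-comm m (k ℕ.* m ℕ.+ 2))
    prefactor-pos : ∀ k → prefactor m (suc k) q ≡ mfact m (+ (k ℕ.* m ℕ.+ 2)) q
    prefactor-pos k = cong (λ x → mfact m x q)
      (trans (cong (_+ + 2) (sym (ℤP.pos-* k m))) (sym (ℤP.pos-+ (k ℕ.* m) 2)))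

atPred : {A : Set} → A → (ℕ → A) → ℕ → A
atPred a g zero    = a
atPred a g (suc k) = g k

module AlternatingSum (m : ℕ) .{{_ : NonZero m}} (q : ℤ) (S : ℕ → ℕ → ℤ)
  (S-0-0 : S 0 0 ≡ + 1) (S-0-suc : ∀ k → S 0 (suc k) ≡ + 0)
  (S-suc : ∀ n k → S (suc n) k ≡ qint (suc (k ℕ.* m)) q ℤ.* S n k ℤ.+ atPred (+ 0) (S n) k)
  where

  open IntegerSums
  open QFactorials
  open import Data.Integer using (_+_; _*_; _^_; -_)
  open import Data.Integer.Solver using (module +-*-Solver)

  alternating : ℕ → ℤ
  alternating n = Σ< (suc n) (λ k → (- q) ^ (n ∸ k) * (prefactor m k q * S n k))

  S-vanishes : ∀ n k → n < k → S n k ≡ + 0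
  S-vanishes zero    (suc k) _         = S-0-suc k
  S-vanishes (suc n) (suc k) (s≤s n<k) = begin
    S (suc n) (suc k)                                          ≡⟨ S-suc n (suc k) ⟩
    qint (suc (suc k ℕ.* m)) q * S n (suc k) + S n k
      ≡⟨ cong₂ (λ x y → qint (suc (suc k ℕ.* m)) q * x + y) (S-vanishes n (suc k) (ℕP.m<n⇒m<1+n n<k)) (S-vanishes n k n<k) ⟩
    qint (suc (suc k ℕ.* m)) q * + 0 + + 0                     ≡⟨ cong (_+ + 0) (ℤP.*-zeroʳ (qint (suc (suc k ℕ.* m)) q)) ⟩
    + 0                                                        ∎
    where open ≡-Reasoning

  alternating-suc : ∀ n → alternating (suc n) ≡ alternating n
  alternating-suc n = begin
    Σ< (2 ℕ.+ n) term                                   ≡⟨ Σ<-cong (2 ℕ.+ n) (λ k _ → split k) ⟩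
    Σ< (2 ℕ.+ n) (λ k → old k + new k)                  ≡⟨ Σ<-+ (2 ℕ.+ n) old new ⟩
    Σ< (1 ℕ.+ n) old + old (suc n) + Σ< (2 ℕ.+ n) new   ≡⟨ cong₂ _+_ (cong (_+_ (Σ< (1 ℕ.+ n) old)) oldLast) (Σ<-suc (suc n) new) ⟩
    Σ< (1 ℕ.+ n) old + + 0 + (new 0 + Σ< (1 ℕ.+ n) (new ∘ suc))
      ≡⟨ cong₂ _+_ (ℤP.+-identityʳ (Σ< (1 ℕ.+ n) old))
                   (trans (cong (_+ Σ< (1 ℕ.+ n) (new ∘ suc)) newFirst) (ℤP.+-identityˡ (Σ< (1 ℕ.+ n) (new ∘ suc)))) ⟩
    Σ< (1 ℕ.+ n) old + Σ< (1 ℕ.+ n) (new ∘ suc)          ≡⟨ Σ<-+ (1 ℕ.+ n) old (new ∘ suc) ⟨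
    Σ< (1 ℕ.+ n) (λ k → old k + new (suc k))            ≡⟨ Σ<-cong (1 ℕ.+ n) merge ⟩
    alternating n                                       ∎
    where
    open ≡-Reasoning
    open +-*-Solver
    sign : ℕ → ℤ
    sign k = (- q) ^ (suc n ∸ k)
    term old new : ℕ → ℤ
    term k = sign k * (prefactor m k q * S (suc n) k)
    old  k = sign k * (prefactor m k q * (qint (suc (k ℕ.* m)) q * S n k))
    new  k = sign k * (prefactor m k q * atPred (+ 0) (S n) k)
    split : ∀ k → term k ≡ old k + new k
    split k = trans (cong (λ x → sign k * (prefactor m k q * x)) (S-suc n k))
      (solve 5 (λ s p c a b → s :* (p :* (c :* a :+ b)) := s :* (p :* (c :* a)) :+ s :* (p :* b)) refl
         (sign k) (prefactor m k q) (qint (suc (k ℕ.* m)) q) (S n k) (atPred (+ 0) (S n) k))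
    oldLast : old (suc n) ≡ + 0
    oldLast = trans (cong (λ x → sign (suc n) * (prefactor m (suc n) q * (qint (suc (suc n ℕ.* m)) q * x)))
                          (S-vanishes n (suc n) ℕP.≤-refl))
      (solve 3 (λ s p c → s :* (p :* (c :* con (+ 0))) := con (+ 0)) refl
         (sign (suc n)) (prefactor m (suc n) q) (qint (suc (suc n ℕ.* m)) q))
    newFirst : new 0 ≡ + 0
    newFirst = solve 2 (λ s p → s :* (p :* con (+ 0)) := con (+ 0)) refl (sign 0) (prefactor m 0 q)
    -- [km+2] = 1 + q [km+1] cancels the extra factor -q of the shifted sign.
    merge : ∀ k → k < suc n → old k + new (suc k) ≡ (- q) ^ (n ∸ k) * (prefactor m k q * S n k)
    merge k (s≤s k≤n) = begin
      sign k * (prefactor m k q * (qint (suc (k ℕ.* m)) q * S n k)) + (- q) ^ (n ∸ k) * (prefactor m (suc k) q * S n k)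
        ≡⟨ cong₂ (λ x y → (- q) ^ x * (prefactor m k q * (qint (suc (k ℕ.* m)) q * S n k)) + (- q) ^ (n ∸ k) * (y * S n k))
             (ℕP.+-∸-assoc 1 k≤n) (trans (prefactor-suc m k q) (cong (_* prefactor m k q) [km+2]≡)) ⟩
      (- q) * (- q) ^ (n ∸ k) * (prefactor m k q * (qint (suc (k ℕ.* m)) q * S n k))
        + (- q) ^ (n ∸ k) * ((+ 1 + q * qint (suc (k ℕ.* m)) q) * prefactor m k q * S n k)
        ≡⟨ solve 5 (λ q s p c a → (:- q) :* s :* (p :* (c :* a)) :+ s :* ((con (+ 1) :+ q :* c) :* p :* a) := s :* (p :* a)) refl
             q ((- q) ^ (n ∸ k)) (prefactor m k q) (qint (suc (k ℕ.* m)) q) (S n k) ⟩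
      (- q) ^ (n ∸ k) * (prefactor m k q * S n k) ∎
      where
      [km+2]≡ : qint (k ℕ.* m ℕ.+ 2) q ≡ + 1 + q * qint (suc (k ℕ.* m)) q
      [km+2]≡ = trans (cong (λ x → qint x q) (ℕP.+-comm (k ℕ.* m) 2)) (qint-suc (suc (k ℕ.* m)) q)

  alternating-one : ∀ n → alternating n ≡ + 1
  alternating-one zero    = trans (cong (λ x → + 0 + + 1 * (x * S 0 0)) (prefactor-zero m q))
                                  (cong (λ x → + 0 + + 1 * (+ 1 * x)) S-0-0)
  alternating-one (suc n) = trans (alternating-suc n) (alternating-one n)

module Lists where

  open import Data.Nat using (_+_)

  private variable A : Set

  T-not⁻ : ∀ {b} → T (not b) → ¬ T b
  T-not⁻ {false} _ ()

  T-not⁺ : ∀ {b} → ¬ T b → T (not b)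
  T-not⁺ {true}  ¬t = ¬t _
  T-not⁺ {false} _  = _

  if-T : ∀ {b} {x y : A} → T b → (if b then x else y) ≡ x
  if-T {b = true} _ = refl

  if-¬T : ∀ {b} {x y : A} → ¬ T b → (if b then x else y) ≡ y
  if-¬T {b = true}  ¬t = ⊥-elim (¬t _)
  if-¬T {b = false} _  = refl

  all⁻ : ∀ {p : A → Bool} xs → T (all p xs) → ∀ x → x ∈ xs → T (p x)
  all⁻ xs h x x∈ = All.lookup (AllP.all⁺ _ xs h) x∈

  all⁺ : ∀ {p : A → Bool} xs → (∀ x → x ∈ xs → T (p x)) → T (all p xs)
  all⁺ xs h = AllP.all⁻ _ (All.tabulate (h _))

  all-witness : ∀ {p : A → Bool} xs → ¬ T (all p xs) → Σ A (λ x → x ∈ xs × ¬ T (p x))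
  all-witness {p = p} xs h = find (AllP.¬All⇒Any¬ (T? ∘ p) xs (h ∘ AllP.all⁻ p))

  any⁻ : ∀ {p : A → Bool} xs → T (any p xs) → Σ A (λ x → x ∈ xs × T (p x))
  any⁻ xs h = find (AnyP.any⁻ _ xs h)

  any⁺ : ∀ {p : A → Bool} {xs} x → x ∈ xs → T (p x) → T (any p xs)
  any⁺ x x∈ px = AnyP.any⁺ _ (lose x∈ px)

  ∈-labels⁺ : ∀ {K l} → 0 < l → l ≤ K → l ∈ map suc (upTo K)
  ∈-labels⁺ {l = suc l} _ l<K = ∈-map⁺ suc (∈-upTo⁺ l<K)

  ∈-labels⁻ : ∀ {K l} → l ∈ map suc (upTo K) → 0 < l × l ≤ K
  ∈-labels⁻ l∈ with _ , x∈ , refl ← ∈-map⁻ suc l∈ = s≤s z≤n , ∈-upTo⁻ x∈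

  upTo-+ : ∀ a b → upTo (a + b) ≡ upTo a ++ map (_+_ a) (upTo b)
  upTo-+ a zero    = trans (cong upTo (ℕP.+-identityʳ a)) (sym (LP.++-identityʳ (upTo a)))
  upTo-+ a (suc b) = begin
    upTo (a + suc b)                                    ≡⟨ cong upTo (ℕP.+-suc a b) ⟩
    upTo (suc (a + b))                                  ≡⟨ LP.upTo-∷ʳ (a + b) ⟨
    upTo (a + b) ++ a + b ∷ []                          ≡⟨ cong (_++ a + b ∷ []) (upTo-+ a b) ⟩
    (upTo a ++ map (_+_ a) (upTo b)) ++ a + b ∷ []       ≡⟨ LP.++-assoc (upTo a) _ _ ⟩
    upTo a ++ (map (_+_ a) (upTo b) ++ a + b ∷ [])       ≡⟨ cong (upTo a ++_) (LP.map-++ (_+_ a) (upTo b) (b ∷ [])) ⟨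
    upTo a ++ map (_+_ a) (upTo b ++ b ∷ [])             ≡⟨ cong (λ xs → upTo a ++ map (_+_ a) xs) (LP.upTo-∷ʳ b) ⟩
    upTo a ++ map (_+_ a) (upTo (suc b))                 ∎
    where open ≡-Reasoning

  count : (ℕ → Bool) → List ℕ → ℕ
  count p xs = length (filterᵇ p xs)

  sumBelow : ℕ → (ℕ → ℕ) → ℕ
  sumBelow zero    g = 0
  sumBelow (suc n) g = sumBelow n g + g n

  sumBelow-cong : ∀ n {g h} → (∀ i → i < n → g i ≡ h i) → sumBelow n g ≡ sumBelow n h
  sumBelow-cong zero    e = refl
  sumBelow-cong (suc n) e = cong₂ _+_ (sumBelow-cong n (λ i i<n → e i (ℕP.m<n⇒m<1+n i<n))) (e n ℕP.≤-refl)

  count-++ : ∀ p xs ys → count p (xs ++ ys) ≡ count p xs + count p ys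
  count-++ p xs ys = trans (cong length (LP.filter-++ (T? ∘ p) xs ys)) (LP.length-++ (filterᵇ p xs))

  count-cong : ∀ {p p'} xs → (∀ x → x ∈ xs → p x ≡ p' x) → count p xs ≡ count p' xs
  count-cong []       e = refl
  count-cong {p} {p'} (x ∷ xs) e with p x | p' x | e x (here refl) | count-cong xs (λ y y∈ → e y (there y∈))
  ... | true  | true  | refl | eq = cong suc eq
  ... | false | false | refl | eq = eq

  count-none : ∀ {p} xs → (∀ x → x ∈ xs → ¬ T (p x)) → count p xs ≡ 0
  count-none xs h = cong length (LP.filter-none (T? ∘ _) (All.tabulate (h _)))

  count-labels-> : ∀ a K → count (a <ᵇ_) (map suc (upTo K)) ≡ K ∸ a
  count-labels-> a zero    = sym (ℕP.0∸n≡0 a)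
  count-labels-> a (suc K) = begin
    count (a <ᵇ_) (map suc (upTo (suc K)))             ≡⟨ cong (count (a <ᵇ_) ∘ map suc) (LP.upTo-∷ʳ K) ⟨
    count (a <ᵇ_) (map suc (upTo K List.∷ʳ K))         ≡⟨ cong (count (a <ᵇ_)) (LP.map-++ suc (upTo K) (K ∷ [])) ⟩
    count (a <ᵇ_) (map suc (upTo K) ++ suc K ∷ [])     ≡⟨ count-++ (a <ᵇ_) (map suc (upTo K)) (suc K ∷ []) ⟩
    count (a <ᵇ_) (map suc (upTo K)) + count (a <ᵇ_) (suc K ∷ []) ≡⟨ cong (_+ count (a <ᵇ_) (suc K ∷ [])) (count-labels-> a K) ⟩
    K ∸ a + count (a <ᵇ_) (suc K ∷ [])                 ≡⟨ step a K ⟩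
    suc K ∸ a                                          ∎
    where
    open ≡-Reasoning
    step : ∀ a K → K ∸ a + count (a <ᵇ_) (suc K ∷ []) ≡ suc K ∸ a
    step a K with a ℕP.≤? K
    ... | yes a≤K rewrite to T-≡ (ℕP.<⇒<ᵇ (s≤s a≤K)) = trans (ℕP.+-comm (K ∸ a) 1) (sym (ℕP.+-∸-assoc 1 a≤K))
    ... | no  a≰K rewrite to T-not-≡ (T-not⁺ (a≰K ∘ ℕP.≤-pred ∘ ℕP.<ᵇ⇒< a (suc K))) =
      trans (ℕP.+-identityʳ (K ∸ a)) (trans (ℕP.m≤n⇒m∸n≡0 (ℕP.<⇒≤ K<a)) (sym (ℕP.m≤n⇒m∸n≡0 K<a)))
      where K<a = ℕP.≰⇒> a≰K

  map-toℕ-allFin : ∀ n → map toℕ (allFin n) ≡ upTo n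
  map-toℕ-allFin zero    = refl
  map-toℕ-allFin (suc n) = cong (0 ∷_) (begin
    map toℕ (List.tabulate Fin.suc)   ≡⟨ LP.map-tabulate Fin.suc toℕ ⟩
    List.tabulate (suc ∘ toℕ)         ≡⟨ LP.map-tabulate id (suc ∘ toℕ) ⟨
    map (suc ∘ toℕ) (allFin n)        ≡⟨ LP.map-∘ (allFin n) ⟩
    map suc (map toℕ (allFin n))      ≡⟨ cong (map suc) (map-toℕ-allFin n) ⟩
    map suc (upTo n)                  ≡⟨ LP.map-upTo suc n ⟩
    List.applyUpTo suc n              ∎)
    where open ≡-Reasoning

  any-cong : ∀ {p p' : A → Bool} xs → (∀ x → p x ≡ p' x) → any p xs ≡ any p' xs
  any-cong xs e = cong or (LP.map-cong e xs)

  all-cong : ∀ {p p' : A → Bool} xs → (∀ x → p x ≡ p' x) → all p xs ≡ all p' xs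
  all-cong xs e = cong and (LP.map-cong e xs)

  any-allFin : ∀ n {p : Fin n → Bool} {p' : ℕ → Bool} → (∀ i → p i ≡ p' (toℕ i)) → any p (allFin n) ≡ any p' (upTo n)
  any-allFin n {p' = p'} e = trans (any-cong (allFin n) e) (trans (cong or (LP.map-∘ (allFin n))) (cong (any p') (map-toℕ-allFin n)))

  all-allFin : ∀ n {p : Fin n → Bool} {p' : ℕ → Bool} → (∀ i → p i ≡ p' (toℕ i)) → all p (allFin n) ≡ all p' (upTo n)
  all-allFin n {p' = p'} e = trans (all-cong (allFin n) e) (trans (cong and (LP.map-∘ (allFin n))) (cong (all p') (map-toℕ-allFin n)))

  any-∷ʳ : ∀ (p : A → Bool) xs x → any p (xs List.∷ʳ x) ≡ any p xs ∨ p x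
  any-∷ʳ p []       x = ∨-identityʳ (p x)
  any-∷ʳ p (y ∷ xs) x = trans (cong (p y ∨_) (any-∷ʳ p xs x)) (sym (∨-assoc (p y) _ _))

  sum-upTo : ∀ n (g : ℕ → ℕ) → sum (map g (upTo n)) ≡ sumBelow n g
  sum-upTo zero    g = refl
  sum-upTo (suc n) g = begin
    sum (map g (upTo (suc n)))          ≡⟨ cong (sum ∘ map g) (LP.upTo-∷ʳ n) ⟨
    sum (map g (upTo n List.∷ʳ n))      ≡⟨ cong sum (LP.map-++ g (upTo n) (n ∷ [])) ⟩
    sum (map g (upTo n) ++ g n ∷ [])    ≡⟨ sum-++ (map g (upTo n)) (g n ∷ []) ⟩
    sum (map g (upTo n)) + (g n + 0)    ≡⟨ cong₂ _+_ (sum-upTo n g) (ℕP.+-identityʳ (g n)) ⟩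
    sumBelow n g + g n            ∎
    where open ≡-Reasoning

  length-filter-map : ∀ {B C : Set} (P : B → Bool) (g : C → B) ys → length (filterᵇ P (map g ys)) ≡ length (filterᵇ (P ∘ g) ys)
  length-filter-map P g []       = refl
  length-filter-map P g (y ∷ ys) with P (g y)
  ... | true  = cong suc (length-filter-map P g ys)
  ... | false = length-filter-map P g ys

  length-filter-cartesianProduct : ∀ {B : Set} (P : A × B → Bool) xs ys →
    length (filterᵇ P (cartesianProduct xs ys)) ≡ sum (map (λ x → length (filterᵇ (λ y → P (x , y)) ys)) xs)
  length-filter-cartesianProduct P []       ys = refl
  length-filter-cartesianProduct P (x ∷ xs) ys = begin
    length (filterᵇ P (map (x ,_) ys ++ cartesianProduct xs ys))
      ≡⟨ cong length (LP.filter-++ (T? ∘ P) (map (x ,_) ys) _) ⟩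
    length (filterᵇ P (map (x ,_) ys) ++ filterᵇ P (cartesianProduct xs ys))
      ≡⟨ LP.length-++ (filterᵇ P (map (x ,_) ys)) ⟩
    length (filterᵇ P (map (x ,_) ys)) + length (filterᵇ P (cartesianProduct xs ys))
      ≡⟨ cong₂ _+_ (length-filter-map P (x ,_) ys) (length-filter-cartesianProduct P xs ys) ⟩
    length (filterᵇ (λ y → P (x , y)) ys) + sum (map (λ x → length (filterᵇ (λ y → P (x , y)) ys)) xs) ∎
    where open ≡-Reasoning

  filter-≤ᵇ-upTo : ∀ K N → K < N → filterᵇ (_≤ᵇ K) (upTo N) ≡ upTo (suc K)
  filter-≤ᵇ-upTo K N K<N = begin
    filterᵇ (_≤ᵇ K) (upTo N)                                                      ≡⟨ cong (filterᵇ (_≤ᵇ K)) split ⟩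
    filterᵇ (_≤ᵇ K) (upTo (suc K) ++ higher)                                      ≡⟨ LP.filter-++ (T? ∘ (_≤ᵇ K)) (upTo (suc K)) higher ⟩
    filterᵇ (_≤ᵇ K) (upTo (suc K)) ++ filterᵇ (_≤ᵇ K) higher
      ≡⟨ cong₂ _++_ (LP.filter-all (T? ∘ (_≤ᵇ K)) (All.tabulate (λ x∈ → ℕP.≤⇒≤ᵇ (ℕP.≤-pred (∈-upTo⁻ x∈)))))
                    (LP.filter-none (T? ∘ (_≤ᵇ K)) (All.tabulate (λ x∈ → above (∈-map⁻ (_+_ (suc K)) x∈)))) ⟩
    upTo (suc K) ++ []                                                            ≡⟨ LP.++-identityʳ _ ⟩
    upTo (suc K)                                                                  ∎
    where
    open ≡-Reasoning
    higher = map (_+_ (suc K)) (upTo (N ∸ suc K))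
    split : upTo N ≡ upTo (suc K) ++ higher
    split = trans (cong upTo (sym (ℕP.m+[n∸m]≡n K<N))) (upTo-+ (suc K) (N ∸ suc K))
    above : ∀ {x} → Σ ℕ (λ y → y ∈ upTo (N ∸ suc K) × x ≡ suc K + y) → ¬ T (x ≤ᵇ K)
    above (y , _ , refl) t = ℕP.<⇒≱ (s≤s (ℕP.m≤m+n K y)) (ℕP.≤ᵇ⇒≤ _ _ t)

module Enumeration where

  open IntegerSums
  open import Data.Integer using (_+_)

  private variable A B : Set

  ΣL-vecs-suc : ∀ (X : List A) n (g : Vec A (suc n) → ℤ) → ΣL (vecs X (suc n)) g ≡ ΣL X (λ x → ΣL (vecs X n) (g ∘ (x ∷_)))
  ΣL-vecs-suc X n g = trans (ΣL-concatMap X _ g) (ΣL-cong X (λ x _ → ΣL-map (vecs X n) (x ∷_) g))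

  ΣL-vecs-∷ʳ : ∀ (X : List A) n (g : Vec A (suc n) → ℤ) → ΣL (vecs X (suc n)) g ≡ ΣL (vecs X n) (λ w → ΣL X (λ x → g (w Vec.∷ʳ x)))
  ΣL-vecs-∷ʳ X zero    g = begin
    ΣL (vecs X 1) g                ≡⟨ ΣL-vecs-suc X 0 g ⟩
    ΣL X (λ x → g (x ∷ []) + + 0)  ≡⟨ ΣL-cong X (λ x _ → ℤP.+-identityʳ (g (x ∷ []))) ⟩
    ΣL X (λ x → g (x ∷ []))        ≡⟨ ℤP.+-identityʳ _ ⟨
    ΣL X (λ x → g (x ∷ [])) + + 0  ∎
    where open ≡-Reasoning
  ΣL-vecs-∷ʳ X (suc n) g = begin
    ΣL (vecs X (2 ℕ.+ n)) g                                                      ≡⟨ ΣL-vecs-suc X (suc n) g ⟩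
    ΣL X (λ y → ΣL (vecs X (suc n)) (g ∘ (y ∷_)))                                ≡⟨ ΣL-cong X (λ y _ → ΣL-vecs-∷ʳ X n (g ∘ (y ∷_))) ⟩
    ΣL X (λ y → ΣL (vecs X n) (λ w → ΣL X (λ x → g (y ∷ (w Vec.∷ʳ x)))))         ≡⟨ ΣL-vecs-suc X n _ ⟨
    ΣL (vecs X (suc n)) (λ v → ΣL X (λ x → g (v Vec.∷ʳ x)))                      ∎
    where open ≡-Reasoning

  ∈-vecs⁻ : ∀ (X : List A) n {w} → w ∈ vecs X n → VAll.All (_∈ X) w
  ∈-vecs⁻ X zero    {[]}    _  = []
  ∈-vecs⁻ X (suc n) {x ∷ w} w∈ with y , y∈ , xw∈ ← find (∈-concatMap⁻ (λ x → map (x ∷_) (vecs X n)) {xs = X} w∈)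
    with w' , w'∈ , refl ← ∈-map⁻ (y ∷_) xw∈ = y∈ ∷ ∈-vecs⁻ X n w'∈

  filter-concatMap : ∀ (p : B → Bool) (f : A → List B) xs → filterᵇ p (concatMap f xs) ≡ concatMap (filterᵇ p ∘ f) xs
  filter-concatMap p f []       = refl
  filter-concatMap p f (x ∷ xs) = trans (LP.filter-++ (T? ∘ p) (f x) _) (cong (filterᵇ p (f x) ++_) (filter-concatMap p f xs))

  concatMap-if : ∀ (b : A → Bool) (f : A → List B) xs → concatMap (λ x → if b x then f x else []) xs ≡ concatMap f (filterᵇ b xs)
  concatMap-if b f []       = refl
  concatMap-if b f (x ∷ xs) with b x
  ... | true  = cong (f x ++_) (concatMap-if b f xs)
  ... | false = concatMap-if b f xs

  filter-map-∷ : ∀ {n} (b : A → Bool) x (V : List (Vec A n)) →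
                 filterᵇ (all b ∘ Vec.toList) (map (x ∷_) V) ≡ (if b x then map (x ∷_) (filterᵇ (all b ∘ Vec.toList) V) else [])
  filter-map-∷ b x []      with b x
  ... | true  = refl
  ... | false = refl
  filter-map-∷ b x (w ∷ V) with b x | all b (Vec.toList w) | filter-map-∷ b x V
  ... | true  | true  | eq = cong ((x ∷ w) ∷_) eq
  ... | true  | false | eq = eq
  ... | false | _     | eq = eq

  filter-vecs : ∀ (b : A → Bool) X n → filterᵇ (all b ∘ Vec.toList) (vecs X n) ≡ vecs (filterᵇ b X) n
  filter-vecs b X zero    = refl
  filter-vecs b X (suc n) = begin
    filterᵇ P (concatMap (λ x → map (x ∷_) (vecs X n)) X)                         ≡⟨ filter-concatMap P _ X ⟩
    concatMap (λ x → filterᵇ P (map (x ∷_) (vecs X n))) X                         ≡⟨ LP.concatMap-cong (λ x → filter-map-∷ b x (vecs X n)) X ⟩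
    concatMap (λ x → if b x then map (x ∷_) (filterᵇ P (vecs X n)) else []) X
      ≡⟨ cong (λ V → concatMap (λ x → if b x then map (x ∷_) V else []) X) (filter-vecs b X n) ⟩
    concatMap (λ x → if b x then map (x ∷_) (vecs (filterᵇ b X) n) else []) X     ≡⟨ concatMap-if b _ X ⟩
    vecs (filterᵇ b X) (suc n)                                                    ∎
    where
    open ≡-Reasoning
    P : ∀ {n} → Vec _ n → Bool
    P = all b ∘ Vec.toList

  map-vecs : ∀ (h : A → B) X n → map (Vec.map h) (vecs X n) ≡ vecs (map h X) n
  map-vecs h X zero    = refl
  map-vecs h X (suc n) = begin
    map (Vec.map h) (concatMap (λ x → map (x ∷_) (vecs X n)) X)        ≡⟨ LP.map-concatMap (Vec.map h) _ X ⟩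
    concatMap (λ x → map (Vec.map h) (map (x ∷_) (vecs X n))) X        ≡⟨ LP.concatMap-cong (λ x → trans (sym (LP.map-∘ (vecs X n)))
                                                                             (trans (LP.map-∘ (vecs X n)) (cong (map (h x ∷_)) (map-vecs h X n)))) X ⟩
    concatMap (λ x → map (h x ∷_) (vecs (map h X) n)) X                ≡⟨ LP.concatMap-map (λ y → map (y ∷_) (vecs (map h X) n)) h X ⟨
    vecs (map h X) (suc n)                                             ∎
    where open ≡-Reasoning

  ΣL-vecs-single : ∀ N n (t : Vec ℕ n) → VAll.All (_< N) t → (h : Vec ℕ n → ℤ) → (∀ x → x ≢ t → h x ≡ + 0) →
                   ΣL (vecs (upTo N) n) h ≡ h t
  ΣL-vecs-single N zero    []      _            h _  = ℤP.+-identityʳ (h [])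
  ΣL-vecs-single N (suc n) (y ∷ t) (y<N ∷ t<N)  h h0 = begin
    ΣL (vecs (upTo N) (suc n)) h                     ≡⟨ ΣL-vecs-suc (upTo N) n h ⟩
    ΣL (upTo N) G                                    ≡⟨ ΣL-upTo N G ⟩
    Σ< N G                                           ≡⟨ Σ<-single N y y<N (λ x _ x≢y → ΣL-zero (vecs (upTo N) n) (λ t' _ → h0 (x ∷ t') (x≢y ∘ VecP.∷-injectiveˡ))) ⟩
    G y                                              ≡⟨ ΣL-vecs-single N n t t<N (h ∘ (y ∷_)) (λ t' t'≢t → h0 (y ∷ t') (t'≢t ∘ VecP.∷-injectiveʳ)) ⟩
    h (y ∷ t)                                        ∎
    where
    open ≡-Reasoning
    G = λ x → ΣL (vecs (upTo N) n) (h ∘ (x ∷_))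

  ΣL-vecs-byHead : ∀ N n (v : ℕ → Vec ℕ (suc n)) (h : Vec ℕ (suc n) → ℤ) → (∀ j → Vec.head (v j) ≡ j) →
                   (∀ j → j < N → VAll.All (_< N) (v j)) → (∀ x → x ≢ v (Vec.head x) → h x ≡ + 0) →
                   ΣL (vecs (upTo N) (suc n)) h ≡ Σ< N (h ∘ v)
  ΣL-vecs-byHead N n v h head-v v<N h0 = begin
    ΣL (vecs (upTo N) (suc n)) h                     ≡⟨ ΣL-vecs-suc (upTo N) n h ⟩
    ΣL (upTo N) (λ j → ΣL (vecs (upTo N) n) (h ∘ (j ∷_)))  ≡⟨ ΣL-cong (upTo N) (λ j j∈ → byHead j (∈-upTo⁻ j∈) (v j) refl (head-v j)) ⟩
    ΣL (upTo N) (h ∘ v)                              ≡⟨ ΣL-upTo N (h ∘ v) ⟩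
    Σ< N (h ∘ v)                                     ∎
    where
    open ≡-Reasoning
    byHead : ∀ j → j < N → (x : Vec ℕ (suc n)) → v j ≡ x → Vec.head x ≡ j → ΣL (vecs (upTo N) n) (h ∘ (j ∷_)) ≡ h (v j)
    byHead j j<N (y ∷ t) vj≡ refl with _ ∷ t<N ← subst (VAll.All (_< N)) vj≡ (v<N j j<N) =
      trans (ΣL-vecs-single N n t t<N (h ∘ (y ∷_)) (λ t' t'≢t → h0 (y ∷ t') (t'≢t ∘ VecP.∷-injectiveʳ ∘ (λ e → trans e vj≡))))
            (cong h (sym vj≡))

module Tables where

  entry : ∀ {m} → Vec ℕ m → ℕ → ℕ
  entry []      c       = 0
  entry (x ∷ r) zero    = x
  entry (x ∷ r) (suc c) = entry r c

  table : ∀ {m n} → Vec (Vec ℕ m) n → ℕ → ℕ → ℕ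
  table []      i       = λ _ → 0
  table (r ∷ w) zero    = entry r
  table (r ∷ w) (suc i) = table w i

  table-∷ʳ : ∀ {m n} (w : Vec (Vec ℕ m) n) x i c → i < n → table (w Vec.∷ʳ x) i c ≡ table w i c
  table-∷ʳ (r ∷ w) x zero    c _         = refl
  table-∷ʳ (r ∷ w) x (suc i) c (s≤s i<n) = table-∷ʳ w x i c i<n

  table-∷ʳ-last : ∀ {m n} (w : Vec (Vec ℕ m) n) x c → table (w Vec.∷ʳ x) n c ≡ entry x c
  table-∷ʳ-last []      x c = refl
  table-∷ʳ-last (r ∷ w) x c = table-∷ʳ-last w x c

  entry-tabulate : ∀ m (f : ℕ → ℕ) c → c < m → entry (Vec.tabulate {n = m} (f ∘ toℕ)) c ≡ f c
  entry-tabulate (suc m) f zero    _         = refl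
  entry-tabulate (suc m) f (suc c) (s≤s c<m) = entry-tabulate m (f ∘ suc) c c<m

  entry-ext : ∀ {m} (x y : Vec ℕ m) → (∀ c → c < m → entry x c ≡ entry y c) → x ≡ y
  entry-ext []      []      _ = refl
  entry-ext (a ∷ x) (b ∷ y) e = cong₂ _∷_ (e 0 (s≤s z≤n)) (entry-ext x y (λ c c<m → e (suc c) (s≤s c<m)))

  entry-bounded : ∀ {m K} (r : Vec ℕ m) → VAll.All (_≤ K) r → ∀ c → entry r c ≤ K
  entry-bounded []      _          c       = z≤n
  entry-bounded (x ∷ r) (x≤ ∷ _)   zero    = x≤
  entry-bounded (x ∷ r) (_ ∷ r≤)   (suc c) = entry-bounded r r≤ c

  table-bounded : ∀ {m n K} (w : Vec (Vec ℕ m) n) → VAll.All (VAll.All (_≤ K)) w → ∀ i c → table w i c ≤ K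
  table-bounded []      _         i       c = z≤n
  table-bounded (r ∷ w) (r≤ ∷ _)  zero    c = entry-bounded r r≤ c
  table-bounded (r ∷ w) (_ ∷ w≤)  (suc i) c = table-bounded w w≤ i c

  table-bounded⁻ : ∀ {m n K} (w : Vec (Vec ℕ m) n) → (∀ i → i < n → ∀ c → c < m → table w i c ≤ K) → VAll.All (VAll.All (_≤ K)) w
  table-bounded⁻ []      _ = []
  table-bounded⁻ (r ∷ w) h = row r (h 0 (s≤s z≤n)) ∷ table-bounded⁻ w (λ i i<n → h (suc i) (s≤s i<n))
    where
    row : ∀ {m} (r : Vec ℕ m) → (∀ c → c < m → entry r c ≤ _) → VAll.All (_≤ _) r
    row []      _ = []
    row (x ∷ r) h = h 0 (s≤s z≤n) ∷ row r (λ c c<m → h (suc c) (s≤s c<m))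

  boundedᵇ : ∀ {m n} → ℕ → Vec (Vec ℕ m) n → Bool
  boundedᵇ K w = all (all (_≤ᵇ K) ∘ Vec.toList) (Vec.toList w)

  boundedᵇ⁻ : ∀ {m n K} (w : Vec (Vec ℕ m) n) → T (boundedᵇ K w) → VAll.All (VAll.All (_≤ K)) w
  boundedᵇ⁻ w h = VAll.map (λ t → VAll.map (ℕP.≤ᵇ⇒≤ _ _) (VAllP.toList⁻ (AllP.all⁺ _ _ t))) (VAllP.toList⁻ (AllP.all⁺ _ _ h))

  boundedᵇ⁺ : ∀ {m n K} (w : Vec (Vec ℕ m) n) → VAll.All (VAll.All (_≤ K)) w → T (boundedᵇ K w)
  boundedᵇ⁺ w h = AllP.all⁻ _ (VAllP.toList⁺ (VAll.map (λ r≤ → AllP.all⁻ _ (VAllP.toList⁺ (VAll.map ℕP.≤⇒≤ᵇ r≤))) h))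

-- Labellings as functions: F i c = j means (i+1)^c ∈ S_j.  The predicates below only
-- look at the rows i < n and at the k groups of non-zero blocks.
module Model (m : ℕ) .{{_ : NonZero m}} where

  open import Data.Nat using (_+_; _*_)

  open Lists

  BlockFn : Set
  BlockFn = ℕ → ℕ → ℕ

  rot : ℕ → ℕ
  rot j = if j % m ≡ᵇ 0 then j ∸ m + 1 else j + 1

  labels : ℕ → List ℕ
  labels k = map suc (upTo (k * m))

  inRow : BlockFn → ℕ → ℕ → Bool
  inRow F i l = any (λ c → F i c ≡ᵇ l) (upTo m)

  occurs : ℕ → BlockFn → ℕ → Bool
  occurs zero    F l = false
  occurs (suc n) F l = occurs n F l ∨ inRow F n l

  firstRow : ℕ → BlockFn → ℕ → ℕ
  firstRow zero    F l = 0
  firstRow (suc n) F l = if occurs n F l then firstRow n F l else if inRow F n l then suc n else 0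

  minBase : ℕ → BlockFn → ℕ → ℕ
  minBase n F zero    = 0
  minBase n F (suc l) = firstRow n F (suc l)

  allOccurᵇ : ℕ → ℕ → BlockFn → Bool
  allOccurᵇ n k F = all (occurs n F) (labels k)

  everyCell : ℕ → (ℕ → ℕ → Bool) → Bool
  everyCell n p = all (λ i → all (p i) (upTo m)) (upTo n)

  zeroRowᵇ : ℕ → BlockFn → Bool
  zeroRowᵇ n F = everyCell n (λ i c → not (F i c ≡ᵇ 0) ∨ all (λ d → F i d ≡ᵇ 0) (upTo m))

  rotationᵇ : ℕ → BlockFn → Bool
  rotationᵇ n F = everyCell n (λ i c → (F i c ≡ᵇ 0) ∨ (F i (suc c % m) ≡ᵇ rot (F i c)))

  minBase-<ᵇ : ℕ → ℕ → BlockFn → Bool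
  minBase-<ᵇ n k F = all (λ l → minBase n F (l * m) <ᵇ minBase n F (suc l * m)) (upTo k)

  minBase-colourᵇ : ℕ → ℕ → BlockFn → Bool
  minBase-colourᵇ n k F = all (λ j → any (λ i → (suc i ≡ᵇ minBase n F j) ∧ (F i (j % m) ≡ᵇ j)) (upTo n)) (labels k)

  isStandardᵇ : ℕ → ℕ → BlockFn → Bool
  isStandardᵇ n k F = allOccurᵇ n k F ∧ zeroRowᵇ n F ∧ rotationᵇ n F ∧ minBase-<ᵇ n k F ∧ minBase-colourᵇ n k F

  RowZeroClosed : BlockFn → ℕ → Set
  RowZeroClosed F i = ∀ c → c < m → F i c ≡ 0 → ∀ d → d < m → F i d ≡ 0

  RowRotationClosed : BlockFn → ℕ → Set
  RowRotationClosed F i = ∀ c → c < m → F i c ≢ 0 → F i (suc c % m) ≡ rot (F i c)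

  record IsStandard (n k : ℕ) (F : BlockFn) : Set where
    field
      occurring : ∀ l → 0 < l → l ≤ k * m → T (occurs n F l)
      zeroRow   : ∀ i → i < n → RowZeroClosed F i
      rotation  : ∀ i → i < n → RowRotationClosed F i
      minBase-< : ∀ l → l < k → minBase n F (l * m) < minBase n F (suc l * m)
      minBase-colour : ∀ l → 0 < l → l ≤ k * m → Σ ℕ (λ i → i < n × suc i ≡ minBase n F l × F i (l % m) ≡ l)

  ≡ᵇ⇒≡ : ∀ {a b} → T (a ≡ᵇ b) → a ≡ b
  ≡ᵇ⇒≡ = ℕP.≡ᵇ⇒≡ _ _

  ≡⇒≡ᵇ : ∀ {a b} → a ≡ b → T (a ≡ᵇ b)
  ≡⇒≡ᵇ = ℕP.≡⇒≡ᵇ _ _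

  isStandardᵇ⇒IsStandard : ∀ n k F → T (isStandardᵇ n k F) → IsStandard n k F
  isStandardᵇ⇒IsStandard n k F h = record
    { occurring = λ l 0<l l≤ → all⁻ (labels k) h₁ l (∈-labels⁺ 0<l l≤)
    ; zeroRow = zeroRow
    ; rotation = rotation
    ; minBase-< = λ l l<k → ℕP.<ᵇ⇒< _ _ (all⁻ (upTo k) h₄ l (∈-upTo⁺ l<k))
    ; minBase-colour = minBase-colour
    }
    where
    h₁ : T (allOccurᵇ n k F)
    h₁ = proj₁ (to T-∧ h)
    h₂₋₅ = proj₂ (to (T-∧ {allOccurᵇ n k F}) h)
    h₂ : T (zeroRowᵇ n F)
    h₂ = proj₁ (to T-∧ h₂₋₅)
    h₃₋₅ = proj₂ (to (T-∧ {zeroRowᵇ n F}) h₂₋₅)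
    h₃ : T (rotationᵇ n F)
    h₃ = proj₁ (to T-∧ h₃₋₅)
    h₄₋₅ = proj₂ (to (T-∧ {rotationᵇ n F}) h₃₋₅)
    h₄ : T (minBase-<ᵇ n k F)
    h₄ = proj₁ (to T-∧ h₄₋₅)
    h₅ : T (minBase-colourᵇ n k F)
    h₅ = proj₂ (to (T-∧ {minBase-<ᵇ n k F}) h₄₋₅)
    rowCondition : ∀ p → T (everyCell n p) → ∀ i → i < n → ∀ c → c < m → T (p i c)
    rowCondition p h i i<n c c<m = all⁻ {p = p i} (upTo m) (all⁻ {p = λ i → all (p i) (upTo m)} (upTo n) h i (∈-upTo⁺ i<n)) c (∈-upTo⁺ c<m)
    zeroRow : ∀ i → i < n → RowZeroClosed F i
    zeroRow i i<n c c<m Fic≡0 d d<m with to T-∨ (rowCondition (λ i c → not (F i c ≡ᵇ 0) ∨ all (λ d → F i d ≡ᵇ 0) (upTo m)) h₂ i i<n c c<m)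
    ... | inj₁ Fic≢0 = ⊥-elim (T-not⁻ Fic≢0 (≡⇒≡ᵇ Fic≡0))
    ... | inj₂ all0  = ≡ᵇ⇒≡ (all⁻ {p = λ d → F i d ≡ᵇ 0} (upTo m) all0 d (∈-upTo⁺ d<m))
    rotation : ∀ i → i < n → RowRotationClosed F i
    rotation i i<n c c<m Fic≢0 with to T-∨ (rowCondition (λ i c → (F i c ≡ᵇ 0) ∨ (F i (suc c % m) ≡ᵇ rot (F i c))) h₃ i i<n c c<m)
    ... | inj₁ Fic≡0 = ⊥-elim (Fic≢0 (≡ᵇ⇒≡ Fic≡0))
    ... | inj₂ rotated = ≡ᵇ⇒≡ rotated
    minBase-colour : ∀ l → 0 < l → l ≤ k * m → Σ ℕ (λ i → i < n × suc i ≡ minBase n F l × F i (l % m) ≡ l)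
    minBase-colour l 0<l l≤ with i , i∈ , t ← any⁻ (upTo n) (all⁻ (labels k) h₅ l (∈-labels⁺ 0<l l≤)) =
      i , ∈-upTo⁻ i∈ , ≡ᵇ⇒≡ (proj₁ (to T-∧ t)) , ≡ᵇ⇒≡ (proj₂ (to T-∧ t))

  IsStandard⇒isStandardᵇ : ∀ n k F → IsStandard n k F → T (isStandardᵇ n k F)
  IsStandard⇒isStandardᵇ n k F S =
    from T-∧ (occ , from T-∧ (zr , from T-∧ (rt , from T-∧ (mb< , mbc))))
    where
    open IsStandard S
    rows : ∀ p → (∀ i → i < n → ∀ c → c < m → T (p i c)) → T (everyCell n p)
    rows p h = all⁺ {p = λ i → all (p i) (upTo m)} (upTo n) (λ i i∈ → all⁺ {p = p i} (upTo m) (λ c c∈ → h i (∈-upTo⁻ i∈) c (∈-upTo⁻ c∈)))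
    occ = all⁺ (labels k) (λ l l∈ → occurring l (proj₁ (∈-labels⁻ l∈)) (proj₂ (∈-labels⁻ l∈)))
    zr = rows (λ i c → not (F i c ≡ᵇ 0) ∨ all (λ d → F i d ≡ᵇ 0) (upTo m)) λ i i<n c c<m → case-zero i i<n c c<m
      where
      case-zero : ∀ i → i < n → ∀ c → c < m → T (not (F i c ≡ᵇ 0) ∨ all (λ d → F i d ≡ᵇ 0) (upTo m))
      case-zero i i<n c c<m with T? (F i c ≡ᵇ 0)
      ... | no  Fic≢0 = from T-∨ (inj₁ (T-not⁺ Fic≢0))
      ... | yes Fic≡0 = from T-∨ (inj₂ (all⁺ {p = λ d → F i d ≡ᵇ 0} (upTo m) (λ d d∈ → ≡⇒≡ᵇ (zeroRow i i<n c c<m (≡ᵇ⇒≡ Fic≡0) d (∈-upTo⁻ d∈)))))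
    rt = rows (λ i c → (F i c ≡ᵇ 0) ∨ (F i (suc c % m) ≡ᵇ rot (F i c))) λ i i<n c c<m → case-zero i i<n c c<m
      where
      case-zero : ∀ i → i < n → ∀ c → c < m → T ((F i c ≡ᵇ 0) ∨ (F i (suc c % m) ≡ᵇ rot (F i c)))
      case-zero i i<n c c<m with T? (F i c ≡ᵇ 0)
      ... | yes Fic≡0 = from T-∨ (inj₁ Fic≡0)
      ... | no  Fic≢0 = from T-∨ (inj₂ (≡⇒≡ᵇ (rotation i i<n c c<m (Fic≢0 ∘ ≡⇒≡ᵇ))))
    mb< = all⁺ (upTo k) (λ l l∈ → ℕP.<⇒<ᵇ (minBase-< l (∈-upTo⁻ l∈)))
    mbc = all⁺ (labels k) (λ l l∈ → let i , i<n , e₁ , e₂ = minBase-colour l (proj₁ (∈-labels⁻ l∈)) (proj₂ (∈-labels⁻ l∈)) in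
                                    any⁺ i (∈-upTo⁺ i<n) (from T-∧ (≡⇒≡ᵇ e₁ , ≡⇒≡ᵇ e₂)))

  isStandard? : ∀ n k F → Dec (IsStandard n k F)
  isStandard? n k F with T? (isStandardᵇ n k F)
  ... | yes t  = yes (isStandardᵇ⇒IsStandard n k F t)
  ... | no  ¬t = no (¬t ∘ IsStandard⇒isStandardᵇ n k F)

  AgreeBelow : ℕ → BlockFn → BlockFn → Set
  AgreeBelow n F F' = ∀ i → i < n → ∀ c → F' i c ≡ F i c

  inRow⁻ : ∀ F i l → T (inRow F i l) → Σ ℕ (λ c → c < m × F i c ≡ l)
  inRow⁻ F i l h with c , c∈ , t ← any⁻ (upTo m) h = c , ∈-upTo⁻ c∈ , ≡ᵇ⇒≡ t

  inRow⁺ : ∀ F i l c → c < m → F i c ≡ l → T (inRow F i l)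
  inRow⁺ F i l c c<m e = any⁺ c (∈-upTo⁺ c<m) (≡⇒≡ᵇ e)

  occurs⁻ : ∀ n F l → T (occurs n F l) → Σ ℕ (λ i → i < n × Σ ℕ (λ c → c < m × F i c ≡ l))
  occurs⁻ (suc n) F l h with to T-∨ h
  ... | inj₁ old = let i , i<n , rest = occurs⁻ n F l old in i , ℕP.m<n⇒m<1+n i<n , rest
  ... | inj₂ new = n , ℕP.≤-refl , inRow⁻ F n l new

  occurs⁺ : ∀ n F l i c → i < n → c < m → F i c ≡ l → T (occurs n F l)
  occurs⁺ (suc n) F l i c i<1+n c<m e with ℕP.m≤n⇒m<n∨m≡n (ℕP.≤-pred i<1+n)
  ... | inj₁ i<n  = from T-∨ (inj₁ (occurs⁺ n F l i c i<n c<m e))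
  ... | inj₂ refl = from T-∨ (inj₂ (inRow⁺ F n l c c<m e))

  inRow-cong : ∀ F F' i l → (∀ c → F' i c ≡ F i c) → inRow F' i l ≡ inRow F i l
  inRow-cong F F' i l e = any-cong (upTo m) (λ c → cong (_≡ᵇ l) (e c))

  occurs-cong : ∀ n {F F'} l → AgreeBelow n F F' → occurs n F' l ≡ occurs n F l
  occurs-cong zero    l A = refl
  occurs-cong (suc n) {F} {F'} l A = cong₂ _∨_ (occurs-cong n l (λ i i<n → A i (ℕP.m<n⇒m<1+n i<n))) (inRow-cong F F' n l (A n ℕP.≤-refl))

  firstRow-cong : ∀ n {F F'} l → AgreeBelow n F F' → firstRow n F' l ≡ firstRow n F l
  firstRow-cong zero    l A = refl
  firstRow-cong (suc n) {F} {F'} l A = trans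
    (cong₂ (λ b r → if b then r else if inRow F' n l then suc n else 0) (occurs-cong n l A') (firstRow-cong n l A'))
    (cong (λ b → if occurs n F l then firstRow n F l else if b then suc n else 0) (inRow-cong F F' n l (A n ℕP.≤-refl)))
    where
    A' : AgreeBelow n F F'
    A' i i<n = A i (ℕP.m<n⇒m<1+n i<n)

  firstRow-≤ : ∀ n F l → firstRow n F l ≤ n
  firstRow-≤ zero    F l = z≤n
  firstRow-≤ (suc n) F l with occurs n F l | inRow F n l
  ... | true  | _     = ℕP.m≤n⇒m≤1+n (firstRow-≤ n F l)
  ... | false | true  = ℕP.≤-refl
  ... | false | false = z≤n

  minBase-≤ : ∀ n F l → minBase n F l ≤ n
  minBase-≤ n F zero    = z≤n
  minBase-≤ n F (suc l) = firstRow-≤ n F (suc l)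

  rowInversions : ℕ → ℕ → BlockFn → ℕ → ℕ
  rowInversions n k F i = count (λ l → (F i 0 <ᵇ l) ∧ (minBase n F l ≤ᵇ suc i)) (labels k)

  inversions : ℕ → ℕ → BlockFn → ℕ
  inversions n k F = sumBelow n (rowInversions n k F)

  -- label g u is the index of S_{gm+u+1}, the u-th block of the group S_{gm+1}, …, S_{(g+1)m}.
  label : ℕ → ℕ → ℕ
  label g u = suc (g * m + u)

  m-1 : ℕ
  m-1 = ℕ.pred m

  m-1<m : m-1 < m
  m-1<m = ℕP.≤-reflexive (ℕP.suc-pred m)

  %-absorbˡ : ∀ x y → (x % m + y) % m ≡ (x + y) % m
  %-absorbˡ x y = begin
    (x % m + y) % m            ≡⟨ %-distribˡ-+ (x % m) y m ⟩
    (x % m % m + y % m) % m    ≡⟨ cong (λ z → (z + y % m) % m) (m%n%n≡m%n x m) ⟩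
    (x % m + y % m) % m        ≡⟨ %-distribˡ-+ x y m ⟨
    (x + y) % m                ∎
    where open ≡-Reasoning

  %-absorbʳ : ∀ x y → (x + y % m) % m ≡ (x + y) % m
  %-absorbʳ x y = trans (cong (_% m) (ℕP.+-comm x (y % m))) (trans (%-absorbˡ y x) (cong (_% m) (ℕP.+-comm y x)))

  [gm+u]%m : ∀ g u → (g * m + u) % m ≡ u % m
  [gm+u]%m g u = trans (cong (_% m) (ℕP.+-comm (g * m) u)) ([m+kn]%n≡m%n u g m)

  [gm+u]/m : ∀ g u → u < m → (g * m + u) / m ≡ g
  [gm+u]/m g u u<m = begin
    (g * m + u) / m        ≡⟨ +-distrib-/ (g * m) u (subst (_< m) (sym (trans (cong (_+ u % m) (m*n%n≡0 g m)) (m<n⇒m%n≡m u<m))) u<m) ⟩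
    g * m / m + u / m      ≡⟨ cong₂ _+_ (m*n/n≡m g m) (m<n⇒m/n≡0 u<m) ⟩
    g + 0                  ≡⟨ ℕP.+-identityʳ g ⟩
    g                      ∎
    where open ≡-Reasoning

  label-% : ∀ g u → label g u % m ≡ suc u % m
  label-% g u = trans (cong (_% m) (sym (ℕP.+-suc (g * m) u))) ([gm+u]%m g (suc u))

  label-m-1 : ∀ g → label g m-1 ≡ suc g * m
  label-m-1 g = trans (sym (ℕP.+-suc (g * m) m-1)) (trans (cong (_+_ (g * m)) (ℕP.suc-pred m)) (ℕP.+-comm (g * m) m))

  label-≤ : ∀ {g u k} → u < m → g < k → label g u ≤ k * m
  label-≤ {g} {u} {k} u<m g<k = begin
    suc (g * m + u)   ≡⟨ ℕP.+-suc (g * m) u ⟨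
    g * m + suc u     ≤⟨ ℕP.+-monoʳ-≤ (g * m) u<m ⟩
    g * m + m         ≡⟨ ℕP.+-comm (g * m) m ⟩
    suc g * m         ≤⟨ ℕP.*-monoˡ-≤ m g<k ⟩
    k * m             ∎
    where open ℕP.≤-Reasoning

  label-> : ∀ g u → g * m < label g u
  label-> g u = s≤s (ℕP.m≤m+n (g * m) u)

  label-surjective : ∀ g l → g * m < l → l ≤ suc g * m → Σ ℕ (λ u → u < m × l ≡ label g u)
  label-surjective g (suc l) gm<l l≤ = l ∸ g * m , u<m , cong suc (sym gm+u≡l)
    where
    gm+u≡l : g * m + (l ∸ g * m) ≡ l
    gm+u≡l = ℕP.m+[n∸m]≡n (ℕP.≤-pred gm<l)
    u<m : l ∸ g * m < m
    u<m = ℕP.+-cancelˡ-< (g * m) _ m (subst (_< g * m + m) (sym gm+u≡l) (subst (l <_) (ℕP.+-comm m (g * m)) l≤))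

  rot-label : ∀ g u → u < m → rot (label g u) ≡ label g (suc u % m)
  rot-label g u u<m rewrite label-% g u with ℕP.m≤n⇒m<n∨m≡n u<m
  ... | inj₁ 1+u<m rewrite m<n⇒m%n≡m 1+u<m = cong suc (trans (ℕP.+-comm (g * m + u) 1) (sym (ℕP.+-suc (g * m) u)))
  ... | inj₂ 1+u≡m rewrite trans (cong (_% m) 1+u≡m) (n%n≡0 m) = trans (ℕP.+-comm _ 1) (cong suc (begin
    suc (g * m + u) ∸ m     ≡⟨ cong (_∸ m) (trans (sym (ℕP.+-suc (g * m) u)) (cong (_+_ (g * m)) 1+u≡m)) ⟩
    g * m + m ∸ m           ≡⟨ ℕP.m+n∸n≡m (g * m) m ⟩
    g * m                   ≡⟨ ℕP.+-identityʳ (g * m) ⟨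
    g * m + 0               ∎))
    where open ≡-Reasoning

  -- orbitRow j is the row of a base whose colour-0 element lies in S_j: by (ii) its colour-c
  -- element lies in ζ^c S_j, the c-th rotation of S_j within its group (in S_0 if j = 0).
  orbitRow : ℕ → ℕ → ℕ
  orbitRow zero    c = 0
  orbitRow (suc j) c = label (j / m) ((j + c) % m)

  orbitRow-0 : ∀ j → orbitRow j 0 ≡ j
  orbitRow-0 zero    = refl
  orbitRow-0 (suc j) = cong suc (begin
    j / m * m + (j + 0) % m   ≡⟨ cong (λ x → j / m * m + x % m) (ℕP.+-identityʳ j) ⟩
    j / m * m + j % m         ≡⟨ ℕP.+-comm (j / m * m) (j % m) ⟩
    j % m + j / m * m         ≡⟨ m≡m%n+[m/n]*n j m ⟨
    j                         ∎)
    where open ≡-Reasoning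

  orbitRow-rot : ∀ j c → orbitRow (suc j) (suc c % m) ≡ rot (orbitRow (suc j) c)
  orbitRow-rot j c = begin
    label (j / m) ((j + suc c % m) % m)       ≡⟨ cong (label (j / m)) (trans (%-absorbʳ j (suc c)) (cong (_% m) (ℕP.+-suc j c))) ⟩
    label (j / m) (suc (j + c) % m)           ≡⟨ cong (label (j / m)) (%-absorbʳ 1 (j + c)) ⟨
    label (j / m) (suc ((j + c) % m) % m)     ≡⟨ rot-label (j / m) ((j + c) % m) (m%n<n (j + c) m) ⟨
    rot (label (j / m) ((j + c) % m))         ∎
    where open ≡-Reasoning

  orbitRow-covers : ∀ j u → u < m → Σ ℕ (λ c → c < m × orbitRow (suc j) c ≡ label (j / m) u)
  orbitRow-covers j u u<m = c , m%n<n _ m , cong (label (j / m)) (begin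
    (j + (u + (m ∸ j % m)) % m) % m     ≡⟨ %-absorbʳ j (u + (m ∸ j % m)) ⟩
    (j + (u + (m ∸ j % m))) % m         ≡⟨ %-absorbˡ j (u + (m ∸ j % m)) ⟨
    (j % m + (u + (m ∸ j % m))) % m     ≡⟨ cong (_% m) (ℕP.+-comm (j % m) _) ⟩
    ((u + (m ∸ j % m)) + j % m) % m     ≡⟨ cong (_% m) (ℕP.+-assoc u (m ∸ j % m) (j % m)) ⟩
    (u + (m ∸ j % m + j % m)) % m       ≡⟨ cong (λ x → (u + x) % m) (ℕP.m∸n+n≡m (ℕP.<⇒≤ (m%n<n j m))) ⟩
    (u + m) % m                         ≡⟨ [m+n]%n≡m%n u m ⟩
    u % m                               ≡⟨ m<n⇒m%n≡m u<m ⟩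
    u                                   ∎)
    where
    open ≡-Reasoning
    c = (u + (m ∸ j % m)) % m

  orbitRow-last : ∀ g u → u < m → orbitRow (suc (g * m + m-1)) (label g u % m) ≡ label g u
  orbitRow-last g u u<m = cong₂ label ([gm+u]/m g m-1 m-1<m) (begin
    (g * m + m-1 + label g u % m) % m    ≡⟨ cong (λ x → (g * m + m-1 + x) % m) (label-% g u) ⟩
    (g * m + m-1 + suc u % m) % m        ≡⟨ %-absorbʳ (g * m + m-1) (suc u) ⟩
    (g * m + m-1 + suc u) % m            ≡⟨ cong (_% m) (ℕP.+-assoc (g * m) m-1 (suc u)) ⟩
    (g * m + (m-1 + suc u)) % m          ≡⟨ [gm+u]%m g (m-1 + suc u) ⟩
    (m-1 + suc u) % m                    ≡⟨ cong (_% m) (trans (ℕP.+-suc m-1 u) (cong (_+ u) (ℕP.suc-pred m))) ⟩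
    (m + u) % m                          ≡⟨ cong (_% m) (ℕP.+-comm m u) ⟩
    (u + m) % m                          ≡⟨ [m+n]%n≡m%n u m ⟩
    u % m                                ≡⟨ m<n⇒m%n≡m u<m ⟩
    u                                    ∎)
    where open ≡-Reasoning

  labels-suc : ∀ g → labels (suc g) ≡ labels g ++ map (label g) (upTo m)
  labels-suc g = begin
    map suc (upTo (m + g * m))                          ≡⟨ cong (map suc ∘ upTo) (ℕP.+-comm m (g * m)) ⟩
    map suc (upTo (g * m + m))                          ≡⟨ cong (map suc) (upTo-+ (g * m) m) ⟩
    map suc (upTo (g * m) ++ map (_+_ (g * m)) (upTo m))   ≡⟨ LP.map-++ suc (upTo (g * m)) _ ⟩
    labels g ++ map suc (map (_+_ (g * m)) (upTo m))       ≡⟨ cong (labels g ++_) (LP.map-∘ (upTo m)) ⟨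
    labels g ++ map (label g) (upTo m)                  ∎
    where open ≡-Reasoning

  module Extension (n : ℕ) (F F' : BlockFn) (A : AgreeBelow n F F') where

    minBase-old : ∀ l → T (occurs n F l) → minBase (suc n) F' l ≡ minBase n F l
    minBase-old zero    _ = refl
    minBase-old (suc l) h rewrite occurs-cong n (suc l) A | to T-≡ h = firstRow-cong n (suc l) A

    minBase-new : ∀ l → 0 < l → ¬ T (occurs n F l) → T (inRow F' n l) → minBase (suc n) F' l ≡ suc n
    minBase-new (suc l) _ ¬old new rewrite occurs-cong n (suc l) A | to T-not-≡ (T-not⁺ ¬old) | to T-≡ new = refl

    occurs-suc⁻ : ∀ l → T (occurs (suc n) F' l) → T (occurs n F l) ⊎ T (inRow F' n l)
    occurs-suc⁻ l h rewrite occurs-cong n l A = to T-∨ h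

    occurs-sucˡ : ∀ l → T (occurs n F l) → T (occurs (suc n) F' l)
    occurs-sucˡ l h rewrite occurs-cong n l A = from T-∨ (inj₁ h)

    occurs-sucʳ : ∀ l → T (inRow F' n l) → T (occurs (suc n) F' l)
    occurs-sucʳ l h = from T-∨ (inj₂ h)

    minBase-agree : ∀ k → (∀ l → 0 < l → l ≤ k * m → T (occurs n F l)) → ∀ l → l ≤ k * m → minBase (suc n) F' l ≡ minBase n F l
    minBase-agree k P zero    _ = refl
    minBase-agree k P (suc l) l≤ = minBase-old (suc l) (P (suc l) (s≤s z≤n) l≤)

    rotation-restrict : (∀ i → i < suc n → RowRotationClosed F' i) → ∀ i → i < n → RowRotationClosed F i
    rotation-restrict closed i i<n c c<m Fic≢0 = trans (sym (A i i<n (suc c % m)))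
      (trans (closed i (ℕP.m<n⇒m<1+n i<n) c c<m (Fic≢0 ∘ trans (sym (A i i<n c)))) (cong rot (A i i<n c)))

    restrict : ∀ k k' → k' ≤ k → IsStandard (suc n) k F' → (∀ l → 0 < l → l ≤ k' * m → T (occurs n F l)) → IsStandard n k' F
    restrict k k' k'≤k S' P = record
      { occurring = P
      ; zeroRow = λ i i<n c c<m e d d<m → trans (sym (A i i<n d)) (zeroRow i (ℕP.m<n⇒m<1+n i<n) c c<m (trans (A i i<n c) e) d d<m)
      ; rotation = rotation-restrict rotation
      ; minBase-< = λ l l<k' → subst₂ _<_ (agree (l * m) (ℕP.*-monoˡ-≤ m (ℕP.<⇒≤ l<k'))) (agree (suc l * m) (ℕP.*-monoˡ-≤ m l<k'))
                                  (minBase-< l (ℕP.<-≤-trans l<k' k'≤k))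
      ; minBase-colour = colour
      }
      where
      open IsStandard S'
      agree = minBase-agree k' P
      colour : ∀ l → 0 < l → l ≤ k' * m → Σ ℕ (λ i → i < n × suc i ≡ minBase n F l × F i (l % m) ≡ l)
      colour l 0<l l≤ with i , _ , e₁ , e₂ ← minBase-colour l 0<l (ℕP.≤-trans l≤ (ℕP.*-monoˡ-≤ m k'≤k)) =
        i , i<n , trans e₁ (agree l l≤) , trans (sym (A i i<n (l % m))) e₂
        where
        i<n : i < n
        i<n = ℕP.≤-trans (ℕP.≤-reflexive (trans e₁ (agree l l≤))) (minBase-≤ n F l)

    zeroRow-suc : (∀ i → i < n → RowZeroClosed F i) → RowZeroClosed F' n → ∀ i → i < suc n → RowZeroClosed F' i
    zeroRow-suc old new i i<1+n c c<m e d d<m with ℕP.m≤n⇒m<n∨m≡n (ℕP.≤-pred i<1+n)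
    ... | inj₁ i<n  = trans (A i i<n d) (old i i<n c c<m (trans (sym (A i i<n c)) e) d d<m)
    ... | inj₂ refl = new c c<m e d d<m

    rotation-suc : (∀ i → i < n → RowRotationClosed F i) → RowRotationClosed F' n → ∀ i → i < suc n → RowRotationClosed F' i
    rotation-suc old new i i<1+n c c<m ne with ℕP.m≤n⇒m<n∨m≡n (ℕP.≤-pred i<1+n)
    ... | inj₁ i<n  = trans (A i i<n (suc c % m)) (trans (old i i<n c c<m (ne ∘ trans (A i i<n c))) (cong rot (sym (A i i<n c))))
    ... | inj₂ refl = new c c<m ne

    extend : ∀ k → IsStandard n k F → RowZeroClosed F' n → RowRotationClosed F' n → IsStandard (suc n) k F'
    extend k S zr rr = record
      { occurring = λ l 0<l l≤ → occurs-sucˡ l (occurring l 0<l l≤)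
      ; zeroRow = zeroRow-suc zeroRow zr
      ; rotation = rotation-suc rotation rr
      ; minBase-< = λ l l<k → subst₂ _<_ (sym (agree (l * m) (ℕP.*-monoˡ-≤ m (ℕP.<⇒≤ l<k)))) (sym (agree (suc l * m) (ℕP.*-monoˡ-≤ m l<k)))
                                 (minBase-< l l<k)
      ; minBase-colour = λ l 0<l l≤ → let i , i<n , e₁ , e₂ = minBase-colour l 0<l l≤ in
                           i , ℕP.m<n⇒m<1+n i<n , trans e₁ (sym (agree l l≤)) , trans (A i i<n (l % m)) e₂
      }
      where
      open IsStandard S
      agree = minBase-agree k occurring

    lastRowInversions : ∀ k → rowInversions (suc n) k F' n ≡ k * m ∸ F' n 0
    lastRowInversions k = trans
      (count-cong (labels k) (λ l _ → trans (cong ((F' n 0 <ᵇ l) ∧_) (to T-≡ (ℕP.≤⇒≤ᵇ (minBase-≤ (suc n) F' l)))) (∧-identityʳ _)))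
      (count-labels-> (F' n 0) (k * m))

    inversions-extend : ∀ k → (∀ l → 0 < l → l ≤ k * m → T (occurs n F l)) →
                        inversions (suc n) k F' ≡ inversions n k F + (k * m ∸ F' n 0)
    inversions-extend k P = cong₂ _+_ (sumBelow-cong n sameRow) (lastRowInversions k)
      where
      sameRow : ∀ i → i < n → rowInversions (suc n) k F' i ≡ rowInversions n k F i
      sameRow i i<n = count-cong (labels k) (λ l l∈ → let 0<l , l≤ = ∈-labels⁻ l∈ in
        cong₂ (λ a b → (a <ᵇ l) ∧ (b ≤ᵇ suc i)) (A i i<n 0) (minBase-old l (P l 0<l l≤)))

    inversions-newGroup : ∀ g → F' n 0 ≡ suc g * m → (∀ u → u < m → minBase (suc n) F' (label g u) ≡ suc n) →
                          (∀ l → 0 < l → l ≤ g * m → T (occurs n F l)) → inversions (suc n) (suc g) F' ≡ inversions n g F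
    inversions-newGroup g F'n0≡ newMin P = begin
      sumBelow n (rowInversions (suc n) (suc g) F') + rowInversions (suc n) (suc g) F' n
        ≡⟨ cong₂ _+_ (sumBelow-cong n sameRow) lastRow ⟩
      inversions n g F + 0 ≡⟨ ℕP.+-identityʳ _ ⟩
      inversions n g F     ∎
      where
      open ≡-Reasoning
      lastRow : rowInversions (suc n) (suc g) F' n ≡ 0
      lastRow = count-none (labels (suc g)) (λ l l∈ t →
        ℕP.<⇒≱ (subst (_< l) F'n0≡ (ℕP.<ᵇ⇒< _ _ (proj₁ (to T-∧ t)))) (proj₂ (∈-labels⁻ l∈)))
      sameRow : ∀ i → i < n → rowInversions (suc n) (suc g) F' i ≡ rowInversions n g F i
      sameRow i i<n = begin
        count p (labels (suc g))                                              ≡⟨ cong (count p) (labels-suc g) ⟩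
        count p (labels g ++ map (label g) (upTo m))                          ≡⟨ count-++ p (labels g) _ ⟩
        count p (labels g) + count p (map (label g) (upTo m))                 ≡⟨ cong₂ _+_ oldLabels newLabels ⟩
        rowInversions n g F i + 0                                             ≡⟨ ℕP.+-identityʳ _ ⟩
        rowInversions n g F i                                                 ∎
        where
        p = λ l → (F' i 0 <ᵇ l) ∧ (minBase (suc n) F' l ≤ᵇ suc i)
        oldLabels : count p (labels g) ≡ rowInversions n g F i
        oldLabels = count-cong (labels g) (λ l l∈ → let 0<l , l≤ = ∈-labels⁻ l∈ in
          cong₂ (λ a b → (a <ᵇ l) ∧ (b ≤ᵇ suc i)) (A i i<n 0) (minBase-old l (P l 0<l l≤)))
        newLabels : count p (map (label g) (upTo m)) ≡ 0
        newLabels = count-none _ (λ l l∈ t → newRow l (∈-map⁻ _ l∈) (proj₂ (to (T-∧ {F' i 0 <ᵇ l}) t)))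
          where
          newRow : ∀ l → Σ ℕ (λ u → u ∈ upTo m × l ≡ label g u) → ¬ T (minBase (suc n) F' l ≤ᵇ suc i)
          newRow l (u , u∈ , refl) t = ℕP.<⇒≱ (s≤s i<n) (subst (_≤ suc i) (newMin u (∈-upTo⁻ u∈)) (ℕP.≤ᵇ⇒≤ _ _ t))

  occurs-rot : ∀ n F → (∀ i → i < n → RowRotationClosed F i) →
               ∀ g u → u < m → T (occurs n F (label g u)) → T (occurs n F (label g (suc u % m)))
  occurs-rot n F closed g u u<m h with i , i<n , c , c<m , e ← occurs⁻ n F _ h =
    occurs⁺ n F _ i (suc c % m) i<n (m%n<n (suc c) m)
      (trans (closed i i<n c c<m (λ Fic≡0 → ℕP.1+n≢0 (trans (sym e) Fic≡0))) (trans (cong rot e) (rot-label g u u<m)))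

  occurs-group : ∀ n F → (∀ i → i < n → RowRotationClosed F i) →
                 ∀ g u u' → u < m → u' < m → T (occurs n F (label g u)) → T (occurs n F (label g u'))
  occurs-group n F closed g u u' u<m u'<m h = subst (T ∘ occurs n F ∘ label g) reach (iterate (u' + (m ∸ u)))
    where
    iterate : ∀ d → T (occurs n F (label g ((u + d) % m)))
    iterate zero    = subst (T ∘ occurs n F ∘ label g) (sym (trans (cong (_% m) (ℕP.+-identityʳ u)) (m<n⇒m%n≡m u<m))) h
    iterate (suc d) = subst (T ∘ occurs n F ∘ label g) (trans (%-absorbʳ 1 (u + d)) (cong (_% m) (sym (ℕP.+-suc u d))))
                        (occurs-rot n F closed g ((u + d) % m) (m%n<n (u + d) m) (iterate d))
    reach : (u + (u' + (m ∸ u))) % m ≡ u'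
    reach = begin
      (u + (u' + (m ∸ u))) % m  ≡⟨ cong (_% m) (trans (sym (ℕP.+-assoc u u' _)) (trans (cong (_+ (m ∸ u)) (ℕP.+-comm u u')) (ℕP.+-assoc u' u _))) ⟩
      (u' + (u + (m ∸ u))) % m  ≡⟨ cong (λ x → (u' + x) % m) (ℕP.m+[n∸m]≡n (ℕP.<⇒≤ u<m)) ⟩
      (u' + m) % m              ≡⟨ [m+n]%n≡m%n u' m ⟩
      u' % m                    ≡⟨ m<n⇒m%n≡m u'<m ⟩
      u'                        ∎
      where open ≡-Reasoning

  Bounded : ℕ → BlockFn → ℕ → Set
  Bounded n F K = ∀ i → i < n → ∀ c → c < m → F i c ≤ K

  IsStandard⇒¬Bounded : ∀ n F g → IsStandard n (suc g) F → ¬ Bounded n F (g * m)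
  IsStandard⇒¬Bounded n F g S bounded
    with i , i<n , c , c<m , e ← occurs⁻ n F _ (IsStandard.occurring S (suc g * m) (subst (0 <_) (label-m-1 g) (s≤s z≤n)) ℕP.≤-refl) =
    ℕP.<⇒≱ (subst (g * m <_) (trans (label-m-1 g) (sym e)) (label-> g m-1)) (bounded i i<n c c<m)

  lastRow-orbit : ∀ n k F → IsStandard (suc n) k F → ∀ c → c < m → F n c ≡ orbitRow (F n 0) c
  lastRow-orbit n k F S with F n 0 in F-n-0
  ... | zero  = IsStandard.zeroRow S n ℕP.≤-refl 0 (ℕ.>-nonZero⁻¹ m) F-n-0
  ... | suc j = orbit
    where
    orbit : ∀ c → c < m → F n c ≡ orbitRow (suc j) c
    orbit zero    _     = trans F-n-0 (sym (orbitRow-0 (suc j)))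
    orbit (suc c) 1+c<m = begin
      F n (suc c)                    ≡⟨ cong (F n) (m<n⇒m%n≡m 1+c<m) ⟨
      F n (suc c % m)                ≡⟨ IsStandard.rotation S n ℕP.≤-refl c c<m Fnc≢0 ⟩
      rot (F n c)                    ≡⟨ cong rot (orbit c c<m) ⟩
      rot (orbitRow (suc j) c)       ≡⟨ orbitRow-rot j c ⟨
      orbitRow (suc j) (suc c % m)   ≡⟨ cong (orbitRow (suc j)) (m<n⇒m%n≡m 1+c<m) ⟩
      orbitRow (suc j) (suc c)       ∎
      where
      open ≡-Reasoning
      c<m = ℕP.<-trans (ℕP.n<1+n c) 1+c<m
      Fnc≢0 : F n c ≢ 0
      Fnc≢0 Fnc≡0 = ℕP.1+n≢0 (trans (sym F-n-0) (IsStandard.zeroRow S n ℕP.≤-refl c c<m Fnc≡0 0 (ℕ.>-nonZero⁻¹ m)))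

  module LastRow (n : ℕ) (F F' : BlockFn) (A : AgreeBelow n F F') where

    open Extension n F F' A

    module ZeroRow (R : ∀ c → c < m → F' n c ≡ 0) where

      extend-zero : ∀ k → IsStandard n k F → IsStandard (suc n) k F'
      extend-zero k S = extend k S (λ _ _ _ d d<m → R d d<m) (λ c c<m Fnc≢0 → ⊥-elim (Fnc≢0 (R c c<m)))

      restrict-zero : ∀ k → IsStandard (suc n) k F' → IsStandard n k F
      restrict-zero k S' = restrict k k ℕP.≤-refl S' old
        where
        old : ∀ l → 0 < l → l ≤ k * m → T (occurs n F l)
        old l 0<l l≤ with occurs-suc⁻ l (IsStandard.occurring S' l 0<l l≤)
        ... | inj₁ occ = occ
        ... | inj₂ new with c , c<m , e ← inRow⁻ F' n l new = ⊥-elim (ℕP.<⇒≢ 0<l (trans (sym (R c c<m)) e))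

      inversions-zero : ∀ k → IsStandard n k F → inversions (suc n) k F' ≡ inversions n k F + k * m
      inversions-zero k S = trans (inversions-extend k (IsStandard.occurring S))
                                  (cong (λ x → inversions n k F + (k * m ∸ x)) (R 0 (ℕ.>-nonZero⁻¹ m)))

    module OrbitRow (j : ℕ) (R : ∀ c → c < m → F' n c ≡ orbitRow (suc j) c) where

      zeroClosed : RowZeroClosed F' n
      zeroClosed c c<m Fnc≡0 = ⊥-elim (ℕP.1+n≢0 (trans (sym (R c c<m)) Fnc≡0))

      rotationClosed : RowRotationClosed F' n
      rotationClosed c c<m _ = trans (R (suc c % m) (m%n<n (suc c) m)) (trans (orbitRow-rot j c) (cong rot (sym (R c c<m))))

      extend-orbit : ∀ k → IsStandard n k F → IsStandard (suc n) k F'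
      extend-orbit k S = extend k S zeroClosed rotationClosed

      inversions-orbit : ∀ k → IsStandard n k F → inversions (suc n) k F' ≡ inversions n k F + (k * m ∸ suc j)
      inversions-orbit k S = trans (inversions-extend k (IsStandard.occurring S))
                                   (cong (λ x → inversions n k F + (k * m ∸ x)) (trans (R 0 (ℕ.>-nonZero⁻¹ m)) (orbitRow-0 (suc j))))

      g = j / m

      inRow-group : ∀ u → u < m → T (inRow F' n (label g u))
      inRow-group u u<m with c , c<m , e ← orbitRow-covers j u u<m = inRow⁺ F' n _ c c<m (trans (R c c<m) e)

      inRow-group⁻ : ∀ l → T (inRow F' n l) → Σ ℕ (λ u → u < m × l ≡ label g u)
      inRow-group⁻ l h with c , c<m , e ← inRow⁻ F' n l h = (j + c) % m , m%n<n (j + c) m , trans (sym e) (R c c<m)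

      minBase-fresh : (∀ u → u < m → ¬ T (occurs n F (label g u))) → ∀ u → u < m → minBase (suc n) F' (label g u) ≡ suc n
      minBase-fresh fresh u u<m = minBase-new _ (s≤s z≤n) (fresh u u<m) (inRow-group u u<m)

      -- When the new row opens the group g, the blocks of g have minimal base n+1.
      opensGroup : ∀ g' → j ≡ g' * m + m-1 → Bounded n F (g' * m) → IsStandard n g' F → IsStandard (suc n) (suc g') F'
      opensGroup g' j≡ bounded S with refl ← trans (cong (_/ m) j≡) ([gm+u]/m g' m-1 m-1<m) = record
        { occurring = occ
        ; zeroRow = zeroRow-suc zeroRow zeroClosed
        ; rotation = rotation-suc rotation rotationClosed
        ; minBase-< = ordered
        ; minBase-colour = colour
        }
        where
        open IsStandard S
        agree = minBase-agree g occurring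
        fresh : ∀ u → u < m → ¬ T (occurs n F (label g u))
        fresh u u<m h with i , i<n , c , c<m , e ← occurs⁻ n F _ h = ℕP.<⇒≱ (label-> g u) (subst (_≤ g * m) e (bounded i i<n c c<m))
        occ : ∀ l → 0 < l → l ≤ suc g * m → T (occurs (suc n) F' l)
        occ l 0<l l≤ with l ℕP.≤? g * m
        ... | yes l≤gm = occurs-sucˡ l (occurring l 0<l l≤gm)
        ... | no  l≰gm with u , u<m , refl ← label-surjective g l (ℕP.≰⇒> l≰gm) l≤ = occurs-sucʳ _ (inRow-group u u<m)
        ordered : ∀ l → l < suc g → minBase (suc n) F' (l * m) < minBase (suc n) F' (suc l * m)
        ordered l l<1+g with ℕP.m≤n⇒m<n∨m≡n (ℕP.≤-pred l<1+g)
        ... | inj₁ l<g  = subst₂ _<_ (sym (agree (l * m) (ℕP.*-monoˡ-≤ m (ℕP.<⇒≤ l<g)))) (sym (agree (suc l * m) (ℕP.*-monoˡ-≤ m l<g)))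
                                     (minBase-< l l<g)
        ... | inj₂ refl = subst₂ _<_ (sym (agree (l * m) ℕP.≤-refl))
                                     (sym (trans (cong (minBase (suc n) F') (sym (label-m-1 l))) (minBase-fresh fresh m-1 m-1<m)))
                                     (s≤s (minBase-≤ n F (l * m)))
        colour : ∀ l → 0 < l → l ≤ suc g * m → Σ ℕ (λ i → i < suc n × suc i ≡ minBase (suc n) F' l × F' i (l % m) ≡ l)
        colour l 0<l l≤ with l ℕP.≤? g * m
        ... | yes l≤gm = let i , i<n , e₁ , e₂ = minBase-colour l 0<l l≤gm in
                         i , ℕP.m<n⇒m<1+n i<n , trans e₁ (sym (agree l l≤gm)) , trans (A i i<n (l % m)) e₂
        ... | no  l≰gm with u , u<m , refl ← label-surjective g l (ℕP.≰⇒> l≰gm) l≤ =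
          n , ℕP.≤-refl , sym (minBase-fresh fresh u u<m) ,
          trans (R _ (m%n<n _ m)) (trans (cong (λ x → orbitRow (suc x) (label g u % m)) j≡) (orbitRow-last g u u<m))

      opensGroup⁻ : ∀ k → j < k * m → Bounded n F (k * m) → ¬ IsStandard n k F → IsStandard (suc n) k F' →
                    Σ ℕ (λ g' → k ≡ suc g' × j ≡ g' * m + m-1 × Bounded n F (g' * m) × IsStandard n g' F
                                × inversions (suc n) k F' ≡ inversions n g' F)
      opensGroup⁻ k j<km bounded ¬S S' = g , k≡1+g , j≡ , bounded-g , S-g , inversions-≡
        where
        open IsStandard S'
        g<k : g < k
        g<k = m<n*o⇒m/o<n j<km
        missing : Σ ℕ (λ l → l ∈ labels k × ¬ T (occurs n F l))
        missing with T? (allOccurᵇ n k F)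
        ... | yes allOcc = ⊥-elim (¬S (restrict k k ℕP.≤-refl S' (λ l 0<l l≤ → all⁻ (labels k) allOcc l (∈-labels⁺ 0<l l≤))))
        ... | no  ¬allOcc = all-witness (labels k) ¬allOcc
        missing-in-g : Σ ℕ (λ u₀ → u₀ < m × ¬ T (occurs n F (label g u₀)))
        missing-in-g with l , l∈ , ¬occ ← missing with occurs-suc⁻ l (occurring l (proj₁ (∈-labels⁻ l∈)) (proj₂ (∈-labels⁻ l∈)))
        ... | inj₁ occ = ⊥-elim (¬occ occ)
        ... | inj₂ new with u₀ , u₀<m , refl ← inRow-group⁻ l new = u₀ , u₀<m , ¬occ
        fresh : ∀ u → u < m → ¬ T (occurs n F (label g u))
        fresh u u<m occ with u₀ , u₀<m , ¬occ ← missing-in-g = ¬occ (occurs-group n F (rotation-restrict rotation) g u u₀ u<m u₀<m occ)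
        minBase-last : minBase (suc n) F' (suc g * m) ≡ suc n
        minBase-last = trans (cong (minBase (suc n) F') (sym (label-m-1 g))) (minBase-fresh fresh m-1 m-1<m)
        k≡1+g : k ≡ suc g
        k≡1+g with ℕP.m≤n⇒m<n∨m≡n g<k
        ... | inj₂ 1+g≡k = sym 1+g≡k
        ... | inj₁ 1+g<k = ⊥-elim (ℕP.<⇒≱ (subst (_< minBase (suc n) F' (suc (suc g) * m)) minBase-last (minBase-< (suc g) 1+g<k))
                                          (minBase-≤ (suc n) F' (suc (suc g) * m)))
        j≡ : j ≡ g * m + m-1
        j≡ with i , _ , e₁ , e₂ ← minBase-colour (suc g * m) (subst (0 <_) (label-m-1 g) (s≤s z≤n)) (ℕP.≤-reflexive (cong (_* m) (sym k≡1+g)))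
          with refl ← ℕP.suc-injective (trans e₁ minBase-last) = ℕP.suc-injective (begin
          suc j                     ≡⟨ trans (R 0 (ℕ.>-nonZero⁻¹ m)) (orbitRow-0 (suc j)) ⟨
          F' n 0                    ≡⟨ cong (F' n) (m*n%n≡0 (suc g) m) ⟨
          F' n (suc g * m % m)      ≡⟨ e₂ ⟩
          suc g * m                 ≡⟨ label-m-1 g ⟨
          suc (g * m + m-1)         ∎)
          where open ≡-Reasoning
        bounded-g : Bounded n F (g * m)
        bounded-g i i<n c c<m with F i c ℕP.≤? g * m
        ... | yes Fic≤gm = Fic≤gm
        ... | no  Fic≰gm with u , u<m , e ← label-surjective g (F i c) (ℕP.≰⇒> Fic≰gm) (subst (F i c ≤_) (cong (_* m) k≡1+g) (bounded i i<n c c<m)) =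
          ⊥-elim (fresh u u<m (occurs⁺ n F _ i c i<n c<m e))
        S-g : IsStandard n g F
        S-g = restrict k g (ℕP.<⇒≤ g<k) S' old
          where
          old : ∀ l → 0 < l → l ≤ g * m → T (occurs n F l)
          old l 0<l l≤ with occurs-suc⁻ l (occurring l 0<l (ℕP.≤-trans l≤ (ℕP.*-monoˡ-≤ m (ℕP.<⇒≤ g<k))))
          ... | inj₁ occ = occ
          ... | inj₂ new with u , u<m , refl ← inRow-group⁻ l new = ⊥-elim (ℕP.<⇒≱ (label-> g u) l≤)
        inversions-≡ : inversions (suc n) k F' ≡ inversions n g F
        inversions-≡ rewrite k≡1+g = inversions-newGroup g F'n0≡ (minBase-fresh fresh) (IsStandard.occurring S-g)
          where
          F'n0≡ : F' n 0 ≡ suc g * m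
          F'n0≡ = trans (R 0 (ℕ.>-nonZero⁻¹ m)) (trans (orbitRow-0 (suc j)) (trans (cong suc j≡) (label-m-1 g)))

module Bridge where

  open import Data.Nat using (_*_)
  open import Data.Fin.Properties using (toℕ-fromℕ<)
  open Lists
  open Tables

  toTable : ∀ {N m n} → Vec (Vec (Fin N) m) n → Vec (Vec ℕ m) n
  toTable = Vec.map (Vec.map toℕ)

  table-toTable : ∀ {N m n} (v : Vec (Vec (Fin N) m) n) i c → table (toTable v) (toℕ i) (toℕ c) ≡ toℕ (Vec.lookup (Vec.lookup v i) c)
  table-toTable (r ∷ v) Fin.zero    c = entry-map r c
    where
    entry-map : ∀ {m} (r : Vec (Fin _) m) c → entry (Vec.map toℕ r) (toℕ c) ≡ toℕ (Vec.lookup r c)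
    entry-map (x ∷ r) Fin.zero    = refl
    entry-map (x ∷ r) (Fin.suc c) = entry-map r c
  table-toTable (r ∷ v) (Fin.suc i) c = table-toTable v i c

  -- Defs.minb is computed by a local function of its where-block; the meta below is
  -- solved by unification with that function, which lets us reason about it on any list.
  mutual
    minbGo : ∀ {n m k} .{{_ : NonZero m}} → Labelling n m k → ℕ → List (Fin n) → ℕ
    minbGo v j = _

    minb≡minbGo : ∀ {n m k} .{{_ : NonZero m}} (v : Labelling n m k) j → D.minb {n} {m} {k} v j ≡ minbGo {n} {m} {k} v j (allFin n)
    minb≡minbGo {n} v j with allFin n
    ... | _ = refl

  module _ {n m k : ℕ} .{{_ : NonZero m}} (v : Labelling n m k) where

    open Model m

    f≡ : ∀ i c → D.f {n} {m} {k} v i c ≡ table (toTable v) (toℕ i) (toℕ c)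
    f≡ i c = sym (table-toTable v i c)

    col≡ : ∀ j → toℕ (D.col {n} {m} {k} v j) ≡ j % m
    col≡ j = toℕ-fromℕ< (m%n<n j m)

    inRow≡ : ∀ i l → any (λ c → D.f {n} {m} {k} v i c ≡ᵇ l) (allFin m) ≡ inRow (table (toTable v)) (toℕ i) l
    inRow≡ i l = any-allFin m (λ c → cong (_≡ᵇ l) (f≡ i c))

    occurs-upTo : ∀ n' l → any (λ i → inRow (table (toTable v)) i l) (upTo n') ≡ occurs n' (table (toTable v)) l
    occurs-upTo zero     l = refl
    occurs-upTo (suc n') l = trans (cong (any _) (sym (LP.upTo-∷ʳ n')))
      (trans (any-∷ʳ _ (upTo n') n') (cong (_∨ inRow (table (toTable v)) n' l) (occurs-upTo n' l)))

    firstRowList : ℕ → List ℕ → ℕ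
    firstRowList l []       = 0
    firstRowList l (i ∷ is) = if inRow (table (toTable v)) i l then suc i else firstRowList l is

    minbGo≡ : ∀ l xs → minbGo {n} {m} {k} v l xs ≡ firstRowList l (map toℕ xs)
    minbGo≡ l []       = refl
    minbGo≡ l (i ∷ is) = cong₂ (λ b r → if b then suc (toℕ i) else r) (inRow≡ i l) (minbGo≡ l is)

    firstRowList-∷ʳ : ∀ l xs x → firstRowList l (xs List.∷ʳ x) ≡
      (if any (λ i → inRow (table (toTable v)) i l) xs then firstRowList l xs else if inRow (table (toTable v)) x l then suc x else 0)
    firstRowList-∷ʳ l []       x = refl
    firstRowList-∷ʳ l (y ∷ xs) x with inRow (table (toTable v)) y l
    ... | true  = refl
    ... | false = firstRowList-∷ʳ l xs x

    firstRow-upTo : ∀ n' l → firstRowList l (upTo n') ≡ firstRow n' (table (toTable v)) l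
    firstRow-upTo zero     l = refl
    firstRow-upTo (suc n') l = trans (cong (firstRowList l) (sym (LP.upTo-∷ʳ n')))
      (trans (firstRowList-∷ʳ l (upTo n') n')
        (cong₂ (λ b r → if b then r else if inRow (table (toTable v)) n' l then suc n' else 0) (occurs-upTo n' l) (firstRow-upTo n' l)))

    s≡ : ∀ j → D.s {n} {m} {k} v j ≡ minBase n (table (toTable v)) j
    s≡ zero    = refl
    s≡ (suc j) = begin
      D.minb {n} {m} {k} v (suc j)                  ≡⟨ minb≡minbGo v (suc j) ⟩
      minbGo v (suc j) (allFin n)                   ≡⟨ minbGo≡ (suc j) (allFin n) ⟩
      firstRowList (suc j) (map toℕ (allFin n))     ≡⟨ cong (firstRowList (suc j)) (map-toℕ-allFin n) ⟩
      firstRowList (suc j) (upTo n)                 ≡⟨ firstRow-upTo n (suc j) ⟩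
      firstRow n (table (toTable v)) (suc j)        ∎
      where open ≡-Reasoning

    isColoredSetPartition≡ : D.isColoredSetPartition {n} {m} {k} v ≡ isStandardᵇ n k (table (toTable v))
    isColoredSetPartition≡ = cong₂ _∧_ nonempty≡ (cong₂ _∧_ condI≡ (cong₂ _∧_ condII≡ (cong₂ _∧_ stdOrder≡ stdColour≡)))
      where
      F = table (toTable v)
      nonempty≡ : D.nonemptyB {n} {m} {k} v ≡ allOccurᵇ n k F
      nonempty≡ = all-cong (labels k) (λ l → trans (any-allFin n (λ i → inRow≡ i l)) (occurs-upTo n l))
      condI≡ : D.condI {n} {m} {k} v ≡ zeroRowᵇ n F
      condI≡ = all-allFin n (λ i → all-allFin m (λ c → cong₂ (λ a b → not (a ≡ᵇ 0) ∨ b) (f≡ i c)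
                 (all-allFin m (λ d → cong (_≡ᵇ 0) (f≡ i d)))))
      condII≡ : D.condII {n} {m} {k} v ≡ rotationᵇ n F
      condII≡ = all-allFin n (λ i → all-allFin m (λ c → cong₂ (λ a b → (a ≡ᵇ 0) ∨ (b ≡ᵇ rot a)) (f≡ i c)
                  (trans (f≡ i (D.ζ {n} {m} {k} v c)) (cong (F (toℕ i)) (col≡ (suc (toℕ c)))))))
      stdOrder≡ : D.stdOrder {n} {m} {k} v ≡ minBase-<ᵇ n k F
      stdOrder≡ = all-cong (upTo k) (λ l → cong₂ _<ᵇ_ (s≡ (l * m)) (s≡ (suc l * m)))
      stdColour≡ : D.stdColour {n} {m} {k} v ≡ minBase-colourᵇ n k F
      stdColour≡ = all-cong (labels k) (λ j → any-allFin n (λ i → cong₂ (λ a b → (suc (toℕ i) ≡ᵇ a) ∧ (b ≡ᵇ j)) (s≡ j)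
                     (trans (f≡ i (D.col {n} {m} {k} v j)) (cong (F (toℕ i)) (col≡ j)))))

    inv≡ : D.inv {n} {m} {k} v ≡ inversions n k (table (toTable v))
    inv≡ = begin
      length (filterᵇ P (cartesianProduct (allFin n) (labels k)))                   ≡⟨ length-filter-cartesianProduct P (allFin n) (labels k) ⟩
      sum (map (λ i → length (filterᵇ (λ l → P (i , l)) (labels k))) (allFin n))   ≡⟨ cong sum (LP.map-cong row≡ (allFin n)) ⟩
      sum (map (rowInversions n k F ∘ toℕ) (allFin n))                               ≡⟨ cong sum (LP.map-∘ (allFin n)) ⟩
      sum (map (rowInversions n k F) (map toℕ (allFin n)))                           ≡⟨ cong (sum ∘ map (rowInversions n k F)) (map-toℕ-allFin n) ⟩
      sum (map (rowInversions n k F) (upTo n))                                       ≡⟨ sum-upTo n (rowInversions n k F) ⟩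
      inversions n k F                                                               ∎
      where
      open ≡-Reasoning
      F = table (toTable v)
      P = λ (p : Fin n × ℕ) → (D.f {n} {m} {k} v (proj₁ p) (D.col {n} {m} {k} v 0) <ᵇ proj₂ p) ∧ (D.s {n} {m} {k} v (proj₂ p) ≤ᵇ suc (toℕ (proj₁ p)))
      row≡ : ∀ i → length (filterᵇ (λ l → P (i , l)) (labels k)) ≡ rowInversions n k F (toℕ i)
      row≡ i = count-cong (labels k) (λ l _ → cong₂ (λ a b → (a <ᵇ l) ∧ (b ≤ᵇ suc (toℕ i)))
                 (trans (f≡ i (D.col {n} {m} {k} v 0)) (cong (F (toℕ i)) (trans (col≡ 0) (m<n⇒m%n≡m (ℕ.>-nonZero⁻¹ m))))) (s≡ l))

module Recurrence (m-1 : ℕ) (q : ℤ) where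

  open IntegerSums
  open QFactorials
  open Lists
  open Tables
  open Enumeration
  open import Data.Integer using (_+_; _*_; _^_)

  m : ℕ
  m = suc m-1

  open Model m hiding (m-1)

  rows : ℕ → List (Vec ℕ m)
  rows k = vecs (upTo (suc (k ℕ.* m))) m

  tables : ∀ n → ℕ → List (Vec (Vec ℕ m) n)
  tables n k = vecs (rows k) n

  weight : ℕ → ℕ → BlockFn → ℤ
  weight n k F = if isStandardᵇ n k F then q ^ inversions n k F else + 0

  weight-standard : ∀ n k F → IsStandard n k F → weight n k F ≡ q ^ inversions n k F
  weight-standard n k F S = if-T (IsStandard⇒isStandardᵇ n k F S)

  weight-nonstandard : ∀ n k F → ¬ IsStandard n k F → weight n k F ≡ + 0
  weight-nonstandard n k F ¬S = if-¬T (¬S ∘ isStandardᵇ⇒IsStandard n k F)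

  Sq-0-0 : Sq m 0 0 q ≡ + 1
  Sq-0-0 = refl

  Sq-0-suc : ∀ k → Sq m 0 (suc k) q ≡ + 0
  Sq-0-suc k = refl

  Sq≡ΣL-tables : ∀ n k → Sq m n k q ≡ ΣL (tables n k) (weight n k ∘ table)
  Sq≡ΣL-tables n k = begin
    ΣL (filterᵇ (D.isColoredSetPartition {n} {m} {k}) (D.allLabellings n m k)) (λ v → q ^ D.inv {n} {m} {k} v)
      ≡⟨ ΣL-filter (D.allLabellings n m k) _ _ ⟩
    ΣL (D.allLabellings n m k) (λ v → if D.isColoredSetPartition {n} {m} {k} v then q ^ D.inv {n} {m} {k} v else + 0)
      ≡⟨ ΣL-cong (D.allLabellings n m k) (λ v _ → cong₂ (λ b i → if b then q ^ i else + 0)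
           (Bridge.isColoredSetPartition≡ {n} {m} {k} v) (Bridge.inv≡ {n} {m} {k} v)) ⟩
    ΣL (D.allLabellings n m k) (weight n k ∘ table ∘ Bridge.toTable)
      ≡⟨ ΣL-map (D.allLabellings n m k) Bridge.toTable _ ⟨
    ΣL (map Bridge.toTable (D.allLabellings n m k)) (weight n k ∘ table)
      ≡⟨ cong (λ ws → ΣL ws (weight n k ∘ table)) toTable-allLabellings ⟩
    ΣL (tables n k) (weight n k ∘ table) ∎
    where
    open ≡-Reasoning
    toTable-allLabellings : map Bridge.toTable (D.allLabellings n m k) ≡ tables n k
    toTable-allLabellings = trans (map-vecs (Vec.map toℕ) _ n) (cong (λ X → vecs X n)
      (trans (map-vecs toℕ (List.allFin (suc (k ℕ.* m))) m) (cong (λ X → vecs X m) (map-toℕ-allFin (suc (k ℕ.* m))))))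

  previousTerm : ∀ n → ℕ → Vec (Vec ℕ m) n → ℤ
  previousTerm n zero    w = + 0
  previousTerm n (suc g) w = if boundedᵇ (g ℕ.* m) w then weight n g (table w) else + 0

  orbitVec : ℕ → Vec ℕ m
  orbitVec j = Vec.tabulate (orbitRow j ∘ toℕ)

  orbitVec-< : ∀ k j → j < suc (k ℕ.* m) → VAll.All (_< suc (k ℕ.* m)) (orbitVec j)
  orbitVec-< k j j≤km = VAllP.tabulate⁺ (λ c → s≤s (bound j (toℕ c) (ℕP.≤-pred j≤km)))
    where
    bound : ∀ j c → j ≤ k ℕ.* m → orbitRow j c ≤ k ℕ.* m
    bound zero     c _   = z≤n
    bound (suc j') c j<km = label-≤ (m%n<n (j' ℕ.+ c) m) (m<n*o⇒m/o<n {n = k} j<km)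

  previousTerm-standard : ∀ n k w → IsStandard n k (table w) → previousTerm n k w ≡ + 0
  previousTerm-standard n zero    w S = refl
  previousTerm-standard n (suc g) w S = if-¬T (λ t → IsStandard⇒¬Bounded n (table w) g S (λ i _ c _ → table-bounded w (boundedᵇ⁻ w t) i c))

  module Prefix (n k : ℕ) (w : Vec (Vec ℕ m) n) where

    F : BlockFn
    F = table w

    F⁺ : Vec ℕ m → BlockFn
    F⁺ x = table (w Vec.∷ʳ x)

    agree : ∀ x → AgreeBelow n F (F⁺ x)
    agree x i i<n c = table-∷ʳ w x i c i<n

    lastRow : ∀ j c → c < m → F⁺ (orbitVec j) n c ≡ orbitRow j c
    lastRow j c c<m = trans (table-∷ʳ-last w (orbitVec j) c) (entry-tabulate m (orbitRow j) c c<m)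

    h : Vec ℕ m → ℤ
    h x = weight (suc n) k (F⁺ x)

    h-orbits : ΣL (rows k) h ≡ h (orbitVec 0) + Σ< (k ℕ.* m) (h ∘ orbitVec ∘ suc)
    h-orbits = trans (ΣL-vecs-byHead (suc (k ℕ.* m)) m-1 orbitVec h orbitRow-0 (orbitVec-< k) h0)
                     (Σ<-suc (k ℕ.* m) (h ∘ orbitVec))
      where
      h0 : ∀ x → x ≢ orbitVec (Vec.head x) → h x ≡ + 0
      h0 x@(_ ∷ _) x≢ with isStandard? (suc n) k (F⁺ x)
      ... | no  ¬S = weight-nonstandard (suc n) k (F⁺ x) ¬S
      ... | yes S  = ⊥-elim (x≢ (entry-ext x (orbitVec (Vec.head x)) (λ c c<m → begin
        entry x c                         ≡⟨ table-∷ʳ-last w x c ⟨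
        F⁺ x n c                          ≡⟨ lastRow-orbit n k (F⁺ x) S c c<m ⟩
        orbitRow (F⁺ x n 0) c             ≡⟨ cong (λ j → orbitRow j c) (table-∷ʳ-last w x 0) ⟩
        orbitRow (entry x 0) c            ≡⟨ entry-tabulate m (orbitRow (Vec.head x)) c c<m ⟨
        entry (orbitVec (Vec.head x)) c   ∎)))
        where open ≡-Reasoning

    module Z = LastRow.ZeroRow n F (F⁺ (orbitVec 0)) (agree (orbitVec 0)) (lastRow 0)
    module O (j : ℕ) = LastRow.OrbitRow n F (F⁺ (orbitVec (suc j))) (agree (orbitVec (suc j))) j (lastRow (suc j))

    rowSum-standard : IsStandard n k F → ΣL (rows k) h ≡ qint (suc (k ℕ.* m)) q * weight n k F + previousTerm n k w
    rowSum-standard S = begin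
      ΣL (rows k) h                                              ≡⟨ h-orbits ⟩
      h (orbitVec 0) + Σ< K (h ∘ orbitVec ∘ suc)                 ≡⟨ cong₂ _+_ zeroRow-term (Σ<-cong K orbitRow-term) ⟩
      q ^ (I ℕ.+ K) + Σ< K (λ j → q ^ (I ℕ.+ (K ∸ suc j)))       ≡⟨ cong₂ _+_ (ℤP.^-distribˡ-+-* q I K)
                                                                      (trans (Σ<-cong K (λ j _ → ℤP.^-distribˡ-+-* q I (K ∸ suc j))) (Σ<-*ˡ K (q ^ I) _)) ⟩
      q ^ I * q ^ K + q ^ I * Σ< K (λ j → q ^ (K ∸ suc j))       ≡⟨ ℤP.*-distribˡ-+ (q ^ I) _ _ ⟨
      q ^ I * (q ^ K + Σ< K (λ j → q ^ (K ∸ suc j)))             ≡⟨ cong (λ x → q ^ I * (q ^ K + x)) (qint-reversed K q) ⟩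
      q ^ I * (q ^ K + qint K q)                                 ≡⟨ cong (q ^ I *_) (trans (ℤP.+-comm (q ^ K) (qint K q)) (sym (qint-sucʳ K q))) ⟩
      q ^ I * qint (suc K) q                                     ≡⟨ ℤP.*-comm (q ^ I) (qint (suc K) q) ⟩
      qint (suc K) q * q ^ I                                     ≡⟨ cong (qint (suc K) q *_) (weight-standard n k F S) ⟨
      qint (suc K) q * weight n k F                              ≡⟨ ℤP.+-identityʳ _ ⟨
      qint (suc K) q * weight n k F + + 0                        ≡⟨ cong (_+_ (qint (suc K) q * weight n k F)) (previousTerm-standard n k w S) ⟨
      qint (suc K) q * weight n k F + previousTerm n k w         ∎
      where
      open ≡-Reasoning
      K = k ℕ.* m
      I = inversions n k F
      zeroRow-term : h (orbitVec 0) ≡ q ^ (I ℕ.+ K)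
      zeroRow-term = trans (weight-standard (suc n) k _ (Z.extend-zero k S)) (cong (q ^_) (Z.inversions-zero k S))
      orbitRow-term : ∀ j → j < K → h (orbitVec (suc j)) ≡ q ^ (I ℕ.+ (K ∸ suc j))
      orbitRow-term j _ = trans (weight-standard (suc n) k _ (O.extend-orbit j k S)) (cong (q ^_) (O.inversions-orbit j k S))

  orbitSum-nonstandard : ∀ n k (w : Vec (Vec ℕ m) n) → (∀ i c → table w i c ≤ k ℕ.* m) → ¬ IsStandard n k (table w) →
                         Σ< (k ℕ.* m) (Prefix.h n k w ∘ orbitVec ∘ suc) ≡ previousTerm n k w
  orbitSum-nonstandard n zero    w bounded ¬S = refl
  orbitSum-nonstandard n (suc g) w bounded ¬S =
    trans (Σ<-single (suc g ℕ.* m) last last<K notLast) lastTerm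
    where
    open Prefix n (suc g) w
    last = g ℕ.* m ℕ.+ m-1
    last<K : last < suc g ℕ.* m
    last<K = ℕP.≤-reflexive (label-m-1 g)
    bounded-K : Bounded n F (suc g ℕ.* m)
    bounded-K i _ c _ = bounded i c
    notLast : ∀ j → j < suc g ℕ.* m → j ≢ last → h (orbitVec (suc j)) ≡ + 0
    notLast j j<K j≢last with isStandard? (suc n) (suc g) (F⁺ (orbitVec (suc j)))
    ... | no  ¬S⁺ = weight-nonstandard (suc n) (suc g) _ ¬S⁺
    ... | yes S⁺ with g' , 1+g≡1+g' , j≡ , _ ← O.opensGroup⁻ j (suc g) j<K bounded-K ¬S S⁺ with refl ← ℕP.suc-injective 1+g≡1+g' =
      ⊥-elim (j≢last j≡)
    lastTerm : h (orbitVec (suc last)) ≡ previousTerm n (suc g) w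
    lastTerm with isStandard? (suc n) (suc g) (F⁺ (orbitVec (suc last)))
    ... | yes S⁺ with g' , 1+g≡1+g' , _ , bounded-g , S-g , inversions≡ ← O.opensGroup⁻ last (suc g) last<K bounded-K ¬S S⁺
                 with refl ← ℕP.suc-injective 1+g≡1+g' = begin
      h (orbitVec (suc last))                   ≡⟨ weight-standard (suc n) (suc g) _ S⁺ ⟩
      q ^ inversions (suc n) (suc g) (F⁺ (orbitVec (suc last)))  ≡⟨ cong (q ^_) inversions≡ ⟩
      q ^ inversions n g F                      ≡⟨ weight-standard n g F S-g ⟨
      weight n g F                              ≡⟨ if-T (boundedᵇ⁺ w (table-bounded⁻ w bounded-g)) ⟨
      previousTerm n (suc g) w                  ∎
      where open ≡-Reasoning
    ... | no ¬S⁺ = trans (weight-nonstandard (suc n) (suc g) _ ¬S⁺) (sym noPrevious)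
      where
      noPrevious : previousTerm n (suc g) w ≡ + 0
      noPrevious with T? (boundedᵇ (g ℕ.* m) w)
      ... | no  ¬b = if-¬T ¬b
      ... | yes b  = trans (if-T b) (weight-nonstandard n g F (λ S-g →
        ¬S⁺ (O.opensGroup last g refl (λ i _ c _ → table-bounded w (boundedᵇ⁻ w b) i c) S-g)))

  rowSum : ∀ n k (w : Vec (Vec ℕ m) n) → (∀ i c → table w i c ≤ k ℕ.* m) →
           ΣL (rows k) (λ x → weight (suc n) k (table (w Vec.∷ʳ x))) ≡ qint (suc (k ℕ.* m)) q * weight n k (table w) + previousTerm n k w
  rowSum n k w bounded with isStandard? n k (table w)
  ... | yes S  = Prefix.rowSum-standard n k w S
  ... | no  ¬S = begin
    ΣL (rows k) h                                         ≡⟨ h-orbits ⟩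
    h (orbitVec 0) + Σ< (k ℕ.* m) (h ∘ orbitVec ∘ suc)    ≡⟨ cong₂ _+_ (weight-nonstandard (suc n) k _ (¬S ∘ Z.restrict-zero k))
                                                                        (orbitSum-nonstandard n k w bounded ¬S) ⟩
    + 0 + previousTerm n k w                              ≡⟨ cong (_+ previousTerm n k w)
                                                               (trans (cong ([km+1] *_) (weight-nonstandard n k F ¬S)) (ℤP.*-zeroʳ [km+1])) ⟨
    [km+1] * weight n k F + previousTerm n k w            ∎
    where
    open ≡-Reasoning
    open Prefix n k w
    [km+1] = qint (suc (k ℕ.* m)) q

  ΣL-previousTerm : ∀ n k → ΣL (tables n k) (previousTerm n k) ≡ atPred (+ 0) (λ g → Sq m n g q) k
  ΣL-previousTerm n zero    = ΣL-zero (tables n 0) (λ _ _ → refl)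
  ΣL-previousTerm n (suc g) = begin
    ΣL (tables n (suc g)) (λ w → if boundedᵇ K w then weight n g (table w) else + 0) ≡⟨ ΣL-filter (tables n (suc g)) (boundedᵇ K) _ ⟨
    ΣL (filterᵇ (boundedᵇ K) (tables n (suc g))) (weight n g ∘ table)              ≡⟨ cong (λ ws → ΣL ws (weight n g ∘ table)) bounded-tables ⟩
    ΣL (tables n g) (weight n g ∘ table)                                           ≡⟨ Sq≡ΣL-tables n g ⟨
    Sq m n g q                                                                     ∎
    where
    open ≡-Reasoning
    K = g ℕ.* m
    bounded-tables : filterᵇ (boundedᵇ K) (tables n (suc g)) ≡ tables n g
    bounded-tables = trans (filter-vecs (all (ℕ._≤ᵇ K) ∘ Vec.toList) (rows (suc g)) n) (cong (λ X → vecs X n)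
      (trans (filter-vecs (ℕ._≤ᵇ K) (upTo (suc (suc g ℕ.* m))) m) (cong (λ X → vecs X m)
        (filter-≤ᵇ-upTo K (suc (suc g ℕ.* m)) (s≤s (ℕP.m≤n+m K m))))))

  Sq-suc : ∀ n k → Sq m (suc n) k q ≡ qint (suc (k ℕ.* m)) q * Sq m n k q + atPred (+ 0) (λ g → Sq m n g q) k
  Sq-suc n k = begin
    Sq m (suc n) k q                                                                   ≡⟨ Sq≡ΣL-tables (suc n) k ⟩
    ΣL (tables (suc n) k) (weight (suc n) k ∘ table)                                   ≡⟨ ΣL-vecs-∷ʳ (rows k) n _ ⟩
    ΣL (tables n k) (λ w → ΣL (rows k) (λ x → weight (suc n) k (table (w Vec.∷ʳ x))))
      ≡⟨ ΣL-cong (tables n k) (λ w w∈ → rowSum n k w (bounded w w∈)) ⟩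
    ΣL (tables n k) (λ w → [km+1] * weight n k (table w) + previousTerm n k w)         ≡⟨ ΣL-+ (tables n k) _ _ ⟩
    ΣL (tables n k) (λ w → [km+1] * weight n k (table w)) + ΣL (tables n k) (previousTerm n k)
      ≡⟨ cong₂ _+_ (ΣL-*ˡ (tables n k) [km+1] _) (ΣL-previousTerm n k) ⟩
    [km+1] * ΣL (tables n k) (weight n k ∘ table) + atPred (+ 0) (λ g → Sq m n g q) k
      ≡⟨ cong (λ s → [km+1] * s + atPred (+ 0) (λ g → Sq m n g q) k) (Sq≡ΣL-tables n k) ⟨
    [km+1] * Sq m n k q + atPred (+ 0) (λ g → Sq m n g q) k                            ∎
    where
    open ≡-Reasoning
    [km+1] = qint (suc (k ℕ.* m)) q
    bounded : ∀ w → w ∈ tables n k → ∀ i c → table w i c ≤ k ℕ.* m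
    bounded w w∈ = table-bounded w (VAll.map (λ r∈ → VAll.map (ℕP.≤-pred ∘ ∈-upTo⁻) (∈-vecs⁻ _ m r∈)) (∈-vecs⁻ (rows k) n w∈))

theorem4p2 : (m n : ℕ) .{{_ : NonZero m}} (q : ℤ) → lhs m n q ≡ + 1
theorem4p2 m@(suc m-1) n q = begin
  lhs m n q        ≡⟨ IntegerSums.ΣL-upTo (suc n) _ ⟩
  alternating n    ≡⟨ alternating-one n ⟩
  + 1              ∎
  where
  open ≡-Reasoning
  open Recurrence m-1 q using (Sq-0-0; Sq-0-suc; Sq-suc)
  open AlternatingSum m q (λ n k → Sq m n k q) Sq-0-0 Sq-0-suc Sq-suc
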